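{- Let $n_1,\dots,n_p\in\mathbb Z$, exactly $k$ of which are odd. Then $-k-4\leq Rs(S_{n_1}+\dots+S_{n_p})\leq Ls(S_{n_1}+\dots+S_{n_p})\leq k+4$.
   Context: Bipartite Influence: on a bipartite graph with black (Left's) and white (Right's) vertices, players alternate; Left picks a black vertex, Right a white one; playing $v$ removes $v$, its neighbours and all vertices that become isolated, credited to the mover; the score is (Left's vertices) minus (Right's vertices); $Ls$ (resp. $Rs$) is the optimal score when Left (resp. Right) starts. For $n\ge1$, $S_n$ is the path on $n$ vertices coloured alternately starting with a black vertex, $S_{ -n}$ the same path starting with a white vertex, $S_0$ is empty; $+$ denotes disjoint union of graphs (disjunctive sum). -}

module Defs where

open import Data.Nat using (ℕ; zero; suc; _∸_; _%_; _⊓_)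
open import Data.Integer using (ℤ; +_; -[1+_]; ∣_∣) renaming (_+_ to _+ℤ_; _-_ to _-ℤ_; _⊔_ to _⊔ℤ_; _⊓_ to _⊓ℤ_)
open import Data.List using (List; []; _∷_; _++_; map; length; take; drop; foldr)
open import Data.Nat.ListAction using (sum)
open import Data.Product using (_×_; _,_)
open import Data.Bool using (Bool; true; false)

-- Vertex colours: black vertices are Left's, white vertices are Right's.
data Colour : Set where
  black white : Colour

flip : Colour → Colour
flip black = white
flip white = black

sameColour : Colour → Colour → Bool
sameColour black black = true
sameColour white white = true
sameColour _ _ = false

-- A connected component: a path, given as the list of the colours of its
-- vertices in order (consecutive vertices are adjacent).
Comp : Set
Comp = List Colour

State : Set
State = List Comp

size : State → ℕ
size G = sum (map length G)

splits : Comp → List (Comp × Colour × Comp)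
splits [] = []
splits (x ∷ xs) = ([] , x , xs) ∷ map (λ { (p , v , s) → (x ∷ p , v , s) }) (splits xs)

isoCount : Comp → ℕ
isoCount (_ ∷ []) = 1
isoCount _ = 0

keep : Comp → State
keep [] = []
keep (_ ∷ []) = []
keep p@(_ ∷ _ ∷ _) = p ∷ []

-- Playing vertex v (with before-part p and after-part s) removes v, its
-- neighbours (last vertex of p, first vertex of s) and the vertices that
-- become isolated.
playAt : Comp × Colour × Comp → ℕ × State
playAt (p , v , s) =
  let l = take (length p ∸ 1) p
      r = drop 1 s
      removed = suc ((1 ⊓ length p) Data.Nat.+ (1 ⊓ length s)
                     Data.Nat.+ isoCount l Data.Nat.+ isoCount r)
  in removed , (keep l ++ keep r)

filterColour : Colour → List (Comp × Colour × Comp) → List (Comp × Colour × Comp)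
filterColour c [] = []
filterColour c (x@(_ , v , _) ∷ xs) with sameColour c v
... | true = x ∷ filterColour c xs
... | false = filterColour c xs

compMoves : Colour → Comp → List (ℕ × State)
compMoves c p = map playAt (filterColour c (splits p))

moves : Colour → State → List (ℕ × State)
moves c [] = []
moves c (p ∷ ps) =
  map (λ { (r , G) → (r , G ++ ps) }) (compMoves c p)
  ++ map (λ { (r , G) → (r , p ∷ G) }) (moves c ps)

-- max / min of a list; a player with no move ends the game (score 0 from here).
bestMax : List ℤ → ℤ
bestMax [] = + 0
bestMax (x ∷ xs) = foldr _⊔ℤ_ x xs

bestMin : List ℤ → ℤ
bestMin [] = + 0
bestMin (x ∷ xs) = foldr _⊓ℤ_ x xs

-- Optimal score of the rest of the game (Left vertices minus Right vertices),
-- with fuel bounding the number of remaining moves (each move removes ≥ 1 vertex).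
mutual
  Lval : ℕ → State → ℤ
  Lval zero G = + 0
  Lval (suc f) G = bestMax (map (λ { (r , G') → + r +ℤ Rval f G' }) (moves black G))

  Rval : ℕ → State → ℤ
  Rval zero G = + 0
  Rval (suc f) G = bestMin (map (λ { (r , G') → Lval f G' -ℤ + r }) (moves white G))

Ls : State → ℤ
Ls G = Lval (size G) G

Rs : State → ℤ
Rs G = Rval (size G) G

altPath : Colour → ℕ → Comp
altPath c zero = []
altPath c (suc n) = c ∷ altPath (flip c) n

S : ℤ → Comp
S (+ n) = altPath black n
S -[1+ n ] = altPath white (suc n)

sumS : List ℤ → State
sumS ns = map S ns

oddCount : List ℤ → ℕ
oddCount [] = 0
oddCount (n ∷ ns) = (∣ n ∣ % 2) Data.Nat.+ oddCount ns

-- Let k(G) be the number of components of G with an odd number of vertices. A move removing r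
-- vertices and leading to H satisfies r + k(H) ≤ k(G) + 4, and on an alternating path with at least
-- three vertices Right has a move with k(H) + 4 ≤ r + k(G), while positions made of paths with at most
-- two vertices are settled directly. Induction on the number of vertices then gives Ls ≤ k + 4 and
-- Rs ≤ k, and exchanging the colours gives Rs ≥ −k − 4.
--
-- For Rs ≤ Ls one proves by simultaneous induction that these positions have no zugzwang: a Right move
-- never helps Left (Ls G' − r ≤ Ls G) and a second Right move never hurts Right (Rs G' − r ≤ Rs G).
-- Two moves in different paths, or far apart on one path, commute; when they are close, alternation of
-- the colours controls the parity of their distance, and what remains is a direct comparison.

module Submission where

open import Defs
open import Data.Bool using (true; false; T)
open import Data.Empty using (⊥-elim)
open import Data.Integer using (ℤ; +_; -_; _-_; _+_; _≤_; _⊔_; _⊓_; +≤+; -≤+; -[1+_]; ∣_∣)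
import Data.Integer.Properties as ZP
open import Data.Integer.Tactic.RingSolver using (solve-∀)
open import Data.List using (List; []; _∷_; _++_; map; length; take; drop; foldr)
import Data.List.Properties as LP
open import Data.List.Membership.Propositional using (_∈_; _∉_)
open import Data.List.Membership.Propositional.Properties
open import Data.List.Relation.Unary.Any using (here; there)
open import Data.List.Relation.Unary.All using (All; []; _∷_; tabulate) renaming (lookup to All-lookup)
import Data.List.Relation.Unary.All.Properties as AllP
open import Data.List.Relation.Binary.Permutation.Propositional using (_↭_; ↭-refl; ↭-sym; ↭-trans; prep; swap; ↭-reflexive)
open import Data.List.Relation.Binary.Permutation.Propositional.Properties hiding (sum-↭)
open import Data.Nat using (ℕ; zero; suc)
import Data.Nat as N
open import Data.Nat.DivMod using (_%_; [m+n]%n≡m%n)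
open import Data.Nat.Induction using (<-wellFounded)
open import Data.Nat.ListAction using (sum)
open import Data.Nat.ListAction.Properties using (sum-↭; sum-++)
import Data.Nat.Properties as NP
open import Data.Nat.Tactic.RingSolver using () renaming (solve-∀ to solve-ℕ)
open import Data.Product using (_×_; _,_; Σ; proj₁; proj₂)
open import Data.Sum using (_⊎_; inj₁; inj₂)
open import Data.Unit using (⊤; tt)
open import Function using (_∘_)
open import Induction.WellFounded using (module All)
open import Level using (0ℓ)
import Relation.Binary.Construct.On as On
open import Relation.Binary.PropositionalEquality using (_≡_; refl; sym; trans; cong; cong₂; subst; subst₂; module ≡-Reasoning)
open import Relation.Nullary using (¬_; yes; no)

-- Moves

sameColour⇒≡ : ∀ c v → sameColour c v ≡ true → c ≡ v
sameColour⇒≡ black black e = refl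
sameColour⇒≡ white white e = refl
sameColour⇒≡ black white ()
sameColour⇒≡ white black ()

sameColour-refl : ∀ c → sameColour c c ≡ true
sameColour-refl black = refl
sameColour-refl white = refl

∈-splits⁻ : ∀ p {t} → t ∈ splits p → Σ Comp λ a → Σ Colour λ v → Σ Comp λ b → (t ≡ (a , v , b)) × (p ≡ a ++ v ∷ b)
∈-splits⁻ (x ∷ xs) (here refl) = [] , x , xs , refl , refl
∈-splits⁻ (x ∷ xs) (there h) with ∈-map⁻ _ h
... | (a , v , b) , h' , refl with ∈-splits⁻ xs h'
... | a' , v' , b' , refl , refl = x ∷ a' , v' , b' , refl , refl

∈-splits⁺ : ∀ a v b → (a , v , b) ∈ splits (a ++ v ∷ b)
∈-splits⁺ [] v b = here refl
∈-splits⁺ (x ∷ a) v b = there (∈-map⁺ _ (∈-splits⁺ a v b))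

∈-filterColour⁻ : ∀ c l {a v b} → (a , v , b) ∈ filterColour c l → ((a , v , b) ∈ l) × (c ≡ v)
∈-filterColour⁻ c ((a' , v' , b') ∷ l) h with sameColour c v' in eq
∈-filterColour⁻ c ((a' , v' , b') ∷ l) (here refl) | true = here refl , sameColour⇒≡ c v' eq
∈-filterColour⁻ c ((a' , v' , b') ∷ l) (there h) | true = let (x , y) = ∈-filterColour⁻ c l h in there x , y
... | false = let (x , y) = ∈-filterColour⁻ c l h in there x , y

∈-filterColour⁺ : ∀ c l {a b} → (a , c , b) ∈ l → (a , c , b) ∈ filterColour c l
∈-filterColour⁺ c ((a' , v' , b') ∷ l) h with sameColour c v' in eq
∈-filterColour⁺ c ((a' , v' , b') ∷ l) (here refl) | true = here refl
∈-filterColour⁺ c ((a' , v' , b') ∷ l) (there h) | true = there (∈-filterColour⁺ c l h)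
∈-filterColour⁺ c ((a' , v' , b') ∷ l) (here refl) | false rewrite sameColour-refl c with eq
... | ()
∈-filterColour⁺ c ((a' , v' , b') ∷ l) (there h) | false = ∈-filterColour⁺ c l h

∈-compMoves⁻ : ∀ c p {r Q} → (r , Q) ∈ compMoves c p →
  Σ Comp λ a → Σ Comp λ b → (p ≡ a ++ c ∷ b) × ((r , Q) ≡ playAt (a , c , b))
∈-compMoves⁻ c p h with ∈-map⁻ playAt h
... | (a , v , b) , h' , eq with ∈-filterColour⁻ c (splits p) h'
... | h'' , refl with ∈-splits⁻ p h''
... | a' , v' , b' , refl , e = a , b , e , eq

∈-compMoves⁺ : ∀ c a b → playAt (a , c , b) ∈ compMoves c (a ++ c ∷ b)
∈-compMoves⁺ c a b = ∈-map⁺ playAt (∈-filterColour⁺ c _ (∈-splits⁺ a c b))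

init : Comp → Comp
init l = take (length l N.∸ 1) l

record Move (c : Colour) (G : State) (r : ℕ) (G' : State) : Set where
  constructor move
  field
    comp : Comp
    rest : State
    before : Comp
    after : Comp
    split : G ↭ comp ∷ rest
    comp≡ : comp ≡ before ++ c ∷ after
    gain≡ : r ≡ proj₁ (playAt (before , c , after))
    result : G' ↭ proj₂ (playAt (before , c , after)) ++ rest

move-at : ∀ c {G} C R a b → G ↭ C ∷ R → C ≡ a ++ c ∷ b →
  Move c G (proj₁ (playAt (a , c , b))) (proj₂ (playAt (a , c , b)) ++ R)
move-at c C R a b p e = move C R a b p e refl ↭-refl

Move-resp-↭ : ∀ {c G₁ G₂ r G'} → G₁ ↭ G₂ → Move c G₁ r G' → Move c G₂ r G'
Move-resp-↭ q (move C R a b p e1 e2 o) = move C R a b (↭-trans (↭-sym q) p) e1 e2 o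

moves⇒Move : ∀ c G {r G'} → (r , G') ∈ moves c G → Move c G r G'
moves⇒Move c (p ∷ ps) h with ∈-++⁻ (map _ (compMoves c p)) h
... | inj₁ h1 with ∈-map⁻ _ h1
... | (r , Q) , h2 , refl with ∈-compMoves⁻ c p h2
... | a , b , e , eq = move p ps a b ↭-refl e (cong proj₁ eq) (↭-reflexive (cong (λ z → proj₂ z ++ ps) eq))
moves⇒Move c (p ∷ ps) h | inj₂ h1 with ∈-map⁻ _ h1
... | (r , H) , h2 , refl with moves⇒Move c ps h2
... | move C R a b pm e1 e2 o =
  move C (p ∷ R) a b (↭-trans (prep p pm) (swap p C ↭-refl)) e1 e2
     (↭-trans (prep p o) (↭-sym (shift p (proj₂ (playAt (a , c , b))) R)))

∈-moves-middle : ∀ {c C r Q} l rs → (r , Q) ∈ compMoves c C → (r , l ++ Q ++ rs) ∈ moves c (l ++ C ∷ rs)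
∈-moves-middle [] rs h = ∈-++⁺ˡ (∈-map⁺ _ h)
∈-moves-middle {c} (p ∷ l) rs h = ∈-++⁺ʳ (map _ (compMoves c p)) (∈-map⁺ _ (∈-moves-middle l rs h))

Move⇒moves : ∀ {c G r G'} → Move c G r G' → Σ State λ H → ((r , H) ∈ moves c G) × (H ↭ G')
Move⇒moves {c} (move C R a b p refl refl o) with ∈-∃++ (∈-resp-↭ (↭-sym p) (here refl))
... | l , rs , refl =
  l ++ Q ++ rs , ∈-moves-middle l rs (∈-compMoves⁺ c a b) ,
  ↭-trans (shifts l Q) (↭-trans (++⁺ˡ Q (drop-mid l [] p)) (↭-sym o))
  where Q = proj₂ (playAt (a , c , b))

∈⇒↭-head : ∀ {A : Set} {x : A} {xs} → x ∈ xs → Σ (List A) λ ys → xs ↭ x ∷ ys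
∈⇒↭-head h with ∈-∃++ h
... | ys , zs , refl = ys ++ zs , shift _ ys zs

Move-comp∈ : ∀ {c G r H} (m : Move c G r H) → Move.comp m ∈ G
Move-comp∈ m = ∈-resp-↭ (↭-sym (Move.split m)) (here refl)

Move-colour∈comp : ∀ {c G r H} (m : Move c G r H) → c ∈ Move.comp m
Move-colour∈comp {c} (move C R a b p refl e2 o) = ∈-++⁺ʳ a (here refl)

∈⇒Move : ∀ {c C G} → c ∈ C → C ∈ G → Σ ℕ λ r → Σ State λ H → Move c G r H
∈⇒Move {c} {C} h hG with ∈-∃++ h | ∈⇒↭-head hG
... | a , b , e | R , p = _ , _ , move-at c C R a b p e

NoMove : Colour → State → Set
NoMove c G = ∀ r G' → ¬ Move c G r G'

All∉⇒NoMove : ∀ {c G} → All (λ C → c ∉ C) G → NoMove c G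
All∉⇒NoMove hA r H m = All-lookup hA (Move-comp∈ m) (Move-colour∈comp m)

NoMove⇒All∉ : ∀ {c G} → NoMove c G → All (λ C → c ∉ C) G
NoMove⇒All∉ {c} {G} n = tabulate (λ {C} hG h → let (r , H , m) = ∈⇒Move h hG in n r H m)

All-keep : ∀ (P : Comp → Set) l → P l → All P (keep l)
All-keep P [] h = []
All-keep P (x ∷ []) h = []
All-keep P (x ∷ y ∷ l) h = h ∷ []

Move-All : ∀ (P : Comp → Set) → (∀ xs ys → P (xs ++ ys) → P xs) → (∀ xs ys → P (xs ++ ys) → P ys) →
  ∀ {c G r H} → All P G → Move c G r H → All P H
Move-All P prefix suffix {c} hG (move C R a b p refl refl o) with All-resp-↭ p hG
... | hC ∷ hR = All-resp-↭ (↭-sym o) (AllP.++⁺ (AllP.++⁺ (All-keep P (init a) pa) (All-keep P (drop 1 b) pb)) hR)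
  where
  pa : P (init a)
  pa = prefix (init a) _ (subst P (sym (LP.take++drop≡id (length a N.∸ 1) a)) (prefix a (c ∷ b) hC))

  pb : P (drop 1 b)
  pb = suffix (take 1 b) _ (subst P (sym (LP.take++drop≡id 1 b)) (suffix (c ∷ []) b (suffix a (c ∷ b) hC)))

NoMove-Move : ∀ {c c' G r H} → NoMove c G → Move c' G r H → NoMove c H
NoMove-Move {c} n m =
  All∉⇒NoMove (Move-All (c ∉_) (λ xs ys h i → h (∈-++⁺ˡ i)) (λ xs ys h i → h (∈-++⁺ʳ xs i)) (NoMove⇒All∉ n) m)

-- Numbers of vertices

size-↭ : ∀ {G H} → G ↭ H → size G ≡ size H
size-↭ p = sum-↭ (map⁺ length p)

size-++ : ∀ G H → size (G ++ H) ≡ size G N.+ size H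
size-++ G H = trans (cong sum (LP.map-++ length G H)) (sum-++ (map length G) (map length H))

length-init : ∀ a → length (init a) ≡ length a N.∸ 1
length-init a = trans (LP.length-take (length a N.∸ 1) a) (NP.m≤n⇒m⊓n≡m (NP.m∸n≤m (length a) 1))

size-keep+isoCount : ∀ l → size (keep l) N.+ isoCount l ≡ length l
size-keep+isoCount [] = refl
size-keep+isoCount (x ∷ []) = refl
size-keep+isoCount (x ∷ y ∷ l) = cong (λ z → suc (suc z)) (trans (NP.+-identityʳ _) (NP.+-identityʳ _))

-- A side of length n of the played vertex loses its neighbour (1 ⊓ n vertices) and leaves the
-- remnant s of length n ∸ 1, which is either kept or removed as isolated.
side-size : ∀ n s → length s ≡ n N.∸ 1 → (1 N.⊓ n) N.+ (size (keep s) N.+ isoCount s) ≡ n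
side-size n s e rewrite size-keep+isoCount s | e with n
... | zero = refl
... | suc _ = refl

playAt-size : ∀ a c b → size (proj₂ (playAt (a , c , b))) N.+ proj₁ (playAt (a , c , b)) ≡ length (a ++ c ∷ b)
playAt-size a c b = begin
  size (keep l ++ keep r) N.+ suc (x N.+ y N.+ isoCount l N.+ isoCount r)
    ≡⟨ cong (N._+ suc (x N.+ y N.+ isoCount l N.+ isoCount r)) (size-++ (keep l) (keep r)) ⟩
  (size (keep l) N.+ size (keep r)) N.+ suc (x N.+ y N.+ isoCount l N.+ isoCount r)
    ≡⟨ regroup (size (keep l)) (size (keep r)) x y (isoCount l) (isoCount r) ⟩
  suc ((x N.+ (size (keep l) N.+ isoCount l)) N.+ (y N.+ (size (keep r) N.+ isoCount r)))
    ≡⟨ cong₂ (λ u v → suc (u N.+ v)) (side-size (length a) l (length-init a)) (side-size (length b) r (LP.length-drop 1 b)) ⟩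
  suc (length a N.+ length b)
    ≡⟨ sym (trans (LP.length-++ a) (NP.+-suc (length a) (length b))) ⟩
  length (a ++ c ∷ b) ∎
  where
  open ≡-Reasoning
  l = init a
  r = drop 1 b
  x = 1 N.⊓ length a
  y = 1 N.⊓ length b
  regroup : ∀ p q x y i j → (p N.+ q) N.+ suc (x N.+ y N.+ i N.+ j) ≡ suc ((x N.+ (p N.+ i)) N.+ (y N.+ (q N.+ j)))
  regroup = solve-ℕ

Move-size : ∀ {c G r G'} → Move c G r G' → size G' N.+ r ≡ size G
Move-size {c} {G} {r} {G'} (move C R a b p refl refl o) = begin
  size G' N.+ r          ≡⟨ cong (N._+ r) (trans (size-↭ o) (size-++ Q R)) ⟩
  size Q N.+ size R N.+ r ≡⟨ NP.+-assoc (size Q) (size R) r ⟩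
  size Q N.+ (size R N.+ r) ≡⟨ cong (size Q N.+_) (NP.+-comm (size R) r) ⟩
  size Q N.+ (r N.+ size R) ≡⟨ sym (NP.+-assoc (size Q) r (size R)) ⟩
  size Q N.+ r N.+ size R ≡⟨ cong (N._+ size R) (playAt-size a c b) ⟩
  size (C ∷ R)           ≡⟨ sym (size-↭ p) ⟩
  size G ∎
  where
  open ≡-Reasoning
  Q = proj₂ (playAt (a , c , b))

Move-size-< : ∀ {c G r G'} → Move c G r G' → size G' N.< size G
Move-size-< {r = r} {G'} m@(move _ _ _ _ _ _ refl _) =
  subst (size G' N.<_) (Move-size m) (NP.m<m+n (size G') (N.s≤s N.z≤n))

Move-gain≤length : ∀ {c G r H} (m : Move c G r H) → r N.≤ length (Move.comp m)
Move-gain≤length {c} (move C R a b p refl refl o) = subst (proj₁ (playAt (a , c , b)) N.≤_) (playAt-size a c b)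
  (NP.m≤n+m _ (size (proj₂ (playAt (a , c , b)))))

size-induction : (P : State → Set) → (∀ G → (∀ {H} → size H N.< size G → P H) → P G) → ∀ G → P G
size-induction = All.wfRec (On.wellFounded size <-wellFounded) 0ℓ

move-induction : (P : State → Set) → (∀ G → (∀ {c r H} → Move c G r H → P H) → P G) → ∀ G → P G
move-induction P step = size-induction P λ G IH → step G λ m → IH (Move-size-< m)

-- Optimal values

foldr-⊔-≥-init : ∀ x xs → x ≤ foldr _⊔_ x xs
foldr-⊔-≥-init x [] = ZP.≤-refl
foldr-⊔-≥-init x (y ∷ xs) = ZP.≤-trans (foldr-⊔-≥-init x xs) (ZP.i≤j⊔i y _)

foldr-⊔-≥-∈ : ∀ {y} x xs → y ∈ xs → y ≤ foldr _⊔_ x xs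
foldr-⊔-≥-∈ x (y ∷ xs) (here refl) = ZP.i≤i⊔j y _
foldr-⊔-≥-∈ x (z ∷ xs) (there h) = ZP.≤-trans (foldr-⊔-≥-∈ x xs h) (ZP.i≤j⊔i z _)

foldr-⊔-∈ : ∀ x xs → foldr _⊔_ x xs ∈ (x ∷ xs)
foldr-⊔-∈ x [] = here refl
foldr-⊔-∈ x (y ∷ xs) with ZP.⊔-sel y (foldr _⊔_ x xs)
... | inj₁ e rewrite e = there (here refl)
... | inj₂ e rewrite e = there' (foldr-⊔-∈ x xs)
  where
  there' : ∀ {z} → z ∈ x ∷ xs → z ∈ x ∷ y ∷ xs
  there' (here q) = here q
  there' (there q) = there (there q)

bestMax-≥ : ∀ {y} xs → y ∈ xs → y ≤ bestMax xs
bestMax-≥ (x ∷ xs) (here refl) = foldr-⊔-≥-init x xs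
bestMax-≥ (x ∷ xs) (there h) = foldr-⊔-≥-∈ x xs h

bestMax-∈ : ∀ x xs → bestMax (x ∷ xs) ∈ x ∷ xs
bestMax-∈ = foldr-⊔-∈

foldr-⊓-≤-init : ∀ x xs → foldr _⊓_ x xs ≤ x
foldr-⊓-≤-init x [] = ZP.≤-refl
foldr-⊓-≤-init x (y ∷ xs) = ZP.≤-trans (ZP.i⊓j≤j y _) (foldr-⊓-≤-init x xs)

foldr-⊓-≤-∈ : ∀ {y} x xs → y ∈ xs → foldr _⊓_ x xs ≤ y
foldr-⊓-≤-∈ x (y ∷ xs) (here refl) = ZP.i⊓j≤i y _
foldr-⊓-≤-∈ x (z ∷ xs) (there h) = ZP.≤-trans (ZP.i⊓j≤j z _) (foldr-⊓-≤-∈ x xs h)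

foldr-⊓-∈ : ∀ x xs → foldr _⊓_ x xs ∈ (x ∷ xs)
foldr-⊓-∈ x [] = here refl
foldr-⊓-∈ x (y ∷ xs) with ZP.⊓-sel y (foldr _⊓_ x xs)
... | inj₁ e rewrite e = there (here refl)
... | inj₂ e rewrite e = there' (foldr-⊓-∈ x xs)
  where
  there' : ∀ {z} → z ∈ x ∷ xs → z ∈ x ∷ y ∷ xs
  there' (here q) = here q
  there' (there q) = there (there q)

bestMin-≤ : ∀ {y} xs → y ∈ xs → bestMin xs ≤ y
bestMin-≤ (x ∷ xs) (here refl) = foldr-⊓-≤-init x xs
bestMin-≤ (x ∷ xs) (there h) = foldr-⊓-≤-∈ x xs h

bestMin-∈ : ∀ x xs → bestMin (x ∷ xs) ∈ x ∷ xs
bestMin-∈ = foldr-⊓-∈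

size≡0⇒moves≡[] : ∀ c G → size G ≡ 0 → moves c G ≡ []
size≡0⇒moves≡[] c G e with moves c G in eq
... | [] = refl
... | (r , G') ∷ _ with Move-size-< (moves⇒Move c G (subst ((r , G') ∈_) (sym eq) (here refl)))
... | q rewrite e with q
... | ()

-- Each move removes a vertex, so any fuel at least the number of vertices gives the same value.
fuel-irrelevant : ∀ f g G → size G N.≤ f → size G N.≤ g → (Lval f G ≡ Lval g G) × (Rval f G ≡ Rval g G)
fuel-irrelevant zero zero G p q = refl , refl
fuel-irrelevant zero (suc g) G p q rewrite size≡0⇒moves≡[] black G (NP.n≤0⇒n≡0 p) | size≡0⇒moves≡[] white G (NP.n≤0⇒n≡0 p) =
  refl , refl
fuel-irrelevant (suc f) zero G p q rewrite size≡0⇒moves≡[] black G (NP.n≤0⇒n≡0 q) | size≡0⇒moves≡[] white G (NP.n≤0⇒n≡0 q) =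
  refl , refl
fuel-irrelevant (suc f) (suc g) G p q =
  cong bestMax (LP.map-cong-local {xs = moves black G} (tabulate λ { {r , H} h → cong (_+_ (+ r)) (proj₂ (IH h)) })) ,
  cong bestMin (LP.map-cong-local {xs = moves white G} (tabulate λ { {r , H} h → cong (_- + r) (proj₁ (IH h)) }))
  where
  IH : ∀ {c r H} → (r , H) ∈ moves c G → (Lval f H ≡ Lval g H) × (Rval f H ≡ Rval g H)
  IH {c} {r} {H} h = fuel-irrelevant f g H (NP.≤-pred (NP.≤-trans lt p)) (NP.≤-pred (NP.≤-trans lt q))
    where lt = Move-size-< (moves⇒Move c G h)

Ls-unfold : ∀ G → Ls G ≡ bestMax (map (λ { (r , H) → + r + Rs H }) (moves black G))
Ls-unfold G =
  trans (proj₁ (fuel-irrelevant (size G) (suc (size G)) G NP.≤-refl (NP.n≤1+n _)))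
        (cong bestMax (LP.map-cong-local {xs = moves black G} (tabulate λ { {r , H} h → cong (_+_ (+ r)) (proj₂ (smaller h)) })))
  where
  smaller : ∀ {r H} → (r , H) ∈ moves black G → (Lval (size G) H ≡ Ls H) × (Rval (size G) H ≡ Rs H)
  smaller {r} {H} h = fuel-irrelevant (size G) (size H) H (NP.<⇒≤ (Move-size-< (moves⇒Move black G h))) NP.≤-refl

Rs-unfold : ∀ G → Rs G ≡ bestMin (map (λ { (r , H) → Ls H - + r }) (moves white G))
Rs-unfold G =
  trans (proj₂ (fuel-irrelevant (size G) (suc (size G)) G NP.≤-refl (NP.n≤1+n _)))
        (cong bestMin (LP.map-cong-local {xs = moves white G} (tabulate λ { {r , H} h → cong (_- + r) (proj₁ (smaller h)) })))
  where
  smaller : ∀ {r H} → (r , H) ∈ moves white G → (Lval (size G) H ≡ Ls H) × (Rval (size G) H ≡ Rs H)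
  smaller {r} {H} h = fuel-irrelevant (size G) (size H) H (NP.<⇒≤ (Move-size-< (moves⇒Move white G h))) NP.≤-refl

Ls-≥-moves : ∀ {G r H} → (r , H) ∈ moves black G → + r + Rs H ≤ Ls G
Ls-≥-moves {G} h = subst (_ ≤_) (sym (Ls-unfold G)) (bestMax-≥ _ (∈-map⁺ _ h))

Rs-≤-moves : ∀ {G r H} → (r , H) ∈ moves white G → Rs G ≤ Ls H - + r
Rs-≤-moves {G} h = subst (_≤ _) (sym (Rs-unfold G)) (bestMin-≤ _ (∈-map⁺ _ h))

moves≡[]⇒NoMove : ∀ {c G} → moves c G ≡ [] → NoMove c G
moves≡[]⇒NoMove e r G' m with Move⇒moves m
... | H , h , _ rewrite e with h
... | ()

Ls-cases : ∀ G → (NoMove black G × (Ls G ≡ + 0)) ⊎ (Σ ℕ λ r → Σ State λ H → Move black G r H × (Ls G ≡ + r + Rs H))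
Ls-cases G with moves black G in eq | Ls-unfold G
... | [] | v = inj₁ (moves≡[]⇒NoMove eq , v)
... | x ∷ xs | v with ∈-map⁻ _ (bestMax-∈ _ (map _ xs))
... | (r , H) , h , e = inj₂ (r , H , moves⇒Move black G (subst (_ ∈_) (sym eq) h) , trans v e)

Rs-cases : ∀ G → (NoMove white G × (Rs G ≡ + 0)) ⊎ (Σ ℕ λ r → Σ State λ H → Move white G r H × (Rs G ≡ Ls H - + r))
Rs-cases G with moves white G in eq | Rs-unfold G
... | [] | v = inj₁ (moves≡[]⇒NoMove eq , v)
... | x ∷ xs | v with ∈-map⁻ _ (bestMin-∈ _ (map _ xs))
... | (r , H) , h , e = inj₂ (r , H , moves⇒Move white G (subst (_ ∈_) (sym eq) h) , trans v e)

Ls-NoMove : ∀ {G} → NoMove black G → Ls G ≡ + 0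
Ls-NoMove {G} n with Ls-cases G
... | inj₁ (_ , v) = v
... | inj₂ (r , H , m , _) = ⊥-elim (n r H m)

Rs-NoMove : ∀ {G} → NoMove white G → Rs G ≡ + 0
Rs-NoMove {G} n with Rs-cases G
... | inj₁ (_ , v) = v
... | inj₂ (r , H , m , _) = ⊥-elim (n r H m)

Ls-Rs-mono-↭ : ∀ G {G'} → G ↭ G' → (Ls G ≤ Ls G') × (Rs G' ≤ Rs G)
Ls-Rs-mono-↭ = size-induction _ λ G IH {G'} p → Ls-mono G IH p , Rs-mono G IH p
  where
  module _ (G : State) (IH : ∀ {H} → size H N.< size G → ∀ {H'} → H ↭ H' → (Ls H ≤ Ls H') × (Rs H' ≤ Rs H)) where
    equal : ∀ {H H'} → size H N.< size G → H ↭ H' → (Ls H ≡ Ls H') × (Rs H ≡ Rs H')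
    equal lt q = ZP.≤-antisym (proj₁ (IH lt q)) (proj₁ (IH lt' (↭-sym q))) ,
                ZP.≤-antisym (proj₂ (IH lt' (↭-sym q))) (proj₂ (IH lt q))
      where lt' = subst (N._< size G) (size-↭ q) lt

    Ls-mono : ∀ {G'} → G ↭ G' → Ls G ≤ Ls G'
    Ls-mono {G'} p with Ls-cases G | Ls-cases G'
    ... | inj₁ (_ , v) | inj₁ (_ , v') = ZP.≤-reflexive (trans v (sym v'))
    ... | inj₂ (r , H , m , _) | inj₁ (nm , _) = ⊥-elim (nm r H (Move-resp-↭ p m))
    ... | inj₁ (nm , _) | inj₂ (r , H , m , _) = ⊥-elim (nm r H (Move-resp-↭ (↭-sym p) m))
    ... | inj₂ (r , H , m , v) | inj₂ _ with Move⇒moves (Move-resp-↭ p m)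
    ... | H' , h , q = subst (_≤ Ls G') (trans (cong (_+_ (+ r)) (sym (proj₂ (equal (Move-size-< m) (↭-sym q))))) (sym v)) (Ls-≥-moves {G'} h)

    Rs-mono : ∀ {G'} → G ↭ G' → Rs G' ≤ Rs G
    Rs-mono {G'} p with Rs-cases G | Rs-cases G'
    ... | inj₁ (_ , v) | inj₁ (_ , v') = ZP.≤-reflexive (trans v' (sym v))
    ... | inj₂ (r , H , m , _) | inj₁ (nm , _) = ⊥-elim (nm r H (Move-resp-↭ p m))
    ... | inj₁ (nm , _) | inj₂ (r , H , m , _) = ⊥-elim (nm r H (Move-resp-↭ (↭-sym p) m))
    ... | inj₂ (r , H , m , v) | inj₂ _ with Move⇒moves (Move-resp-↭ p m)
    ... | H' , h , q = subst (Rs G' ≤_) (trans (cong (_- + r) (sym (proj₁ (equal (Move-size-< m) (↭-sym q))))) (sym v)) (Rs-≤-moves {G'} h)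

Ls-resp-↭ : ∀ {G H} → G ↭ H → Ls G ≡ Ls H
Ls-resp-↭ {G} {H} p = ZP.≤-antisym (proj₁ (Ls-Rs-mono-↭ G p)) (proj₁ (Ls-Rs-mono-↭ H (↭-sym p)))

Rs-resp-↭ : ∀ {G H} → G ↭ H → Rs G ≡ Rs H
Rs-resp-↭ {G} {H} p = ZP.≤-antisym (proj₂ (Ls-Rs-mono-↭ H (↭-sym p))) (proj₂ (Ls-Rs-mono-↭ G p))

Ls-≥-Move : ∀ {G r G'} → Move black G r G' → + r + Rs G' ≤ Ls G
Ls-≥-Move {G} {r} {G'} m with Move⇒moves m
... | H , h , q = subst (_≤ Ls G) (cong (_+_ (+ r)) (Rs-resp-↭ q)) (Ls-≥-moves {G} h)

Rs-≤-Move : ∀ {G r G'} → Move white G r G' → Rs G ≤ Ls G' - + r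
Rs-≤-Move {G} {r} {G'} m with Move⇒moves m
... | H , h , q = subst (Rs G ≤_) (cong (_- + r) (Ls-resp-↭ q)) (Rs-≤-moves {G} h)

Ls-≤ : ∀ {G B} → (NoMove black G → + 0 ≤ B) → (∀ {r H} → Move black G r H → + r + Rs H ≤ B) → Ls G ≤ B
Ls-≤ {G} z m with Ls-cases G
... | inj₁ (n , v) rewrite v = z n
... | inj₂ (r , H , q , v) rewrite v = m q

Rs-≥ : ∀ {G B} → (NoMove white G → B ≤ + 0) → (∀ {r H} → Move white G r H → B ≤ Ls H - + r) → B ≤ Rs G
Rs-≥ {G} z m with Rs-cases G
... | inj₁ (n , v) rewrite v = z n
... | inj₂ (r , H , q , v) rewrite v = m q

-- Alternating paths

Alternating : Comp → Set
Alternating [] = ⊤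
Alternating (x ∷ []) = ⊤
Alternating (x ∷ y ∷ l) = (y ≡ flip x) × Alternating (y ∷ l)

Alternating-++⁻ˡ : ∀ xs ys → Alternating (xs ++ ys) → Alternating xs
Alternating-++⁻ˡ [] ys h = tt
Alternating-++⁻ˡ (x ∷ []) ys h = tt
Alternating-++⁻ˡ (x ∷ y ∷ xs) ys (e , h) = e , Alternating-++⁻ˡ (y ∷ xs) ys h

Alternating-++⁻ʳ : ∀ xs ys → Alternating (xs ++ ys) → Alternating ys
Alternating-++⁻ʳ [] ys h = h
Alternating-++⁻ʳ (x ∷ []) [] h = tt
Alternating-++⁻ʳ (x ∷ []) (y ∷ ys) (e , h) = h
Alternating-++⁻ʳ (x ∷ y ∷ xs) ys (e , h) = Alternating-++⁻ʳ (y ∷ xs) ys h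

Alternating-take : ∀ n l → Alternating l → Alternating (take n l)
Alternating-take n l h = Alternating-++⁻ˡ (take n l) (drop n l) (subst Alternating (sym (LP.take++drop≡id n l)) h)

Alternating-drop : ∀ n l → Alternating l → Alternating (drop n l)
Alternating-drop n l h = Alternating-++⁻ʳ (take n l) (drop n l) (subst Alternating (sym (LP.take++drop≡id n l)) h)

AllAlternating : State → Set
AllAlternating G = All Alternating G

Move-AllAlternating : ∀ {c G r H} → AllAlternating G → Move c G r H → AllAlternating H
Move-AllAlternating = Move-All Alternating Alternating-++⁻ˡ Alternating-++⁻ʳ

Move-Alternating : ∀ {c G r H} → AllAlternating G → (m : Move c G r H) → Alternating (Move.comp m)
Move-Alternating hA m = All-lookup hA (Move-comp∈ m)

-- Odd components and the upper bounds

parity : ℕ → ℕ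
parity zero = 0
parity (suc zero) = 1
parity (suc (suc n)) = parity n

oddComponents : State → ℕ
oddComponents G = sum (map (λ C → parity (length C)) G)

oddComponents-↭ : ∀ {G H} → G ↭ H → oddComponents G ≡ oddComponents H
oddComponents-↭ p = sum-↭ (map⁺ (λ C → parity (length C)) p)

oddComponents-++ : ∀ G H → oddComponents (G ++ H) ≡ oddComponents G N.+ oddComponents H
oddComponents-++ G H = trans (cong sum (LP.map-++ (λ C → parity (length C)) G H)) (sum-++ (map (λ C → parity (length C)) G) _)

isolated : ℕ → ℕ
isolated (suc zero) = 1
isolated _ = 0

oddKept : ℕ → ℕ
oddKept zero = 0
oddKept (suc zero) = 0
oddKept (suc (suc n)) = parity n

isoCount≡isolated : ∀ l → isoCount l ≡ isolated (length l)
isoCount≡isolated [] = refl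
isoCount≡isolated (x ∷ []) = refl
isoCount≡isolated (x ∷ y ∷ l) = refl

oddComponents-keep : ∀ l → oddComponents (keep l) ≡ oddKept (length l)
oddComponents-keep [] = refl
oddComponents-keep (x ∷ []) = refl
oddComponents-keep (x ∷ y ∷ l) = NP.+-identityʳ _

extraGain : ℕ → ℕ → ℕ
extraGain x y = (1 N.⊓ x) N.+ (1 N.⊓ y) N.+ isolated (x N.∸ 1) N.+ isolated (y N.∸ 1)

oddAfter : ℕ → ℕ → ℕ
oddAfter x y = oddKept (x N.∸ 1) N.+ oddKept (y N.∸ 1)

record MoveShape (G : State) (r : ℕ) (H : State) : Set where
  constructor shape
  field
    before after others : ℕ
    odd-before : oddComponents G ≡ parity (before N.+ suc after) N.+ others
    odd-after : oddComponents H ≡ oddAfter before after N.+ others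
    gain : r ≡ suc (extraGain before after)

Move-shape : ∀ {c G r H} → Move c G r H → MoveShape G r H
Move-shape {c} {G} {r} {H} (move C R a b p ce re o) = shape (length a) (length b) (oddComponents R) kg kh rr
  where
  kg : oddComponents G ≡ parity (length a N.+ suc (length b)) N.+ oddComponents R
  kg = trans (oddComponents-↭ p) (cong (λ n → parity n N.+ oddComponents R) (trans (cong length ce) (LP.length-++ a)))
  kh : oddComponents H ≡ oddAfter (length a) (length b) N.+ oddComponents R
  kh = trans (oddComponents-↭ o) (trans (oddComponents-++ (keep (init a) ++ keep (drop 1 b)) R)
        (cong (N._+ oddComponents R) (trans (oddComponents-++ (keep (init a)) (keep (drop 1 b)))
          (cong₂ N._+_ (trans (oddComponents-keep (init a)) (cong oddKept (length-init a)))
                       (trans (oddComponents-keep (drop 1 b)) (cong oddKept (LP.length-drop 1 b)))))))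
  rr : r ≡ suc (extraGain (length a) (length b))
  rr = trans re (cong suc (cong₂ N._+_ (cong₂ N._+_ refl (trans (isoCount≡isolated (init a)) (cong isolated (length-init a))))
                  (trans (isoCount≡isolated (drop 1 b)) (cong isolated (LP.length-drop 1 b)))))

≤-compute : ∀ {m n} → {t : T (m N.≤ᵇ n)} → m N.≤ n
≤-compute {m} {n} {t} = NP.≤ᵇ⇒≤ m n t

sideCost : ℕ → ℕ
sideCost x = (1 N.⊓ x) N.+ isolated (x N.∸ 1) N.+ oddKept (x N.∸ 1)

sideCost-period : ∀ n → sideCost (suc (suc (suc n))) ≡ sideCost (suc n)
sideCost-period zero = refl
sideCost-period (suc zero) = refl
sideCost-period (suc (suc n)) = refl

-- Both sides are 2-periodic in x and in y from 1 on, so nine cases suffice.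
gain-bound-arith : ∀ x y → suc (sideCost x N.+ sideCost y) N.≤ parity (x N.+ suc y) N.+ 4
gain-bound-arith (suc (suc (suc n))) y =
  subst (λ z → suc (z N.+ sideCost y) N.≤ parity (suc n N.+ suc y) N.+ 4) (sym (sideCost-period n)) (gain-bound-arith (suc n) y)
gain-bound-arith x (suc (suc (suc n))) =
  subst₂ (λ z w → suc (sideCost x N.+ z) N.≤ parity w N.+ 4) (sym (sideCost-period n)) (sym (+2 x n)) (gain-bound-arith x (suc n))
  where
  +2 : ∀ x n → x N.+ suc (suc (suc (suc n))) ≡ suc (suc (x N.+ suc (suc n)))
  +2 x n = trans (NP.+-suc x _) (cong suc (NP.+-suc x _))
gain-bound-arith 0 0 = ≤-compute
gain-bound-arith 0 1 = ≤-compute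
gain-bound-arith 0 2 = ≤-compute
gain-bound-arith 1 0 = ≤-compute
gain-bound-arith 1 1 = ≤-compute
gain-bound-arith 1 2 = ≤-compute
gain-bound-arith 2 0 = ≤-compute
gain-bound-arith 2 1 = ≤-compute
gain-bound-arith 2 2 = ≤-compute

Move-gain-bound : ∀ {c G r H} → Move c G r H → r N.+ oddComponents H N.≤ oddComponents G N.+ 4
Move-gain-bound {G = G} {H = H} m with Move-shape m
... | shape x y k odd-G odd-H refl = begin
  suc (extraGain x y) N.+ oddComponents H            ≡⟨ cong (suc (extraGain x y) N.+_) odd-H ⟩
  suc (extraGain x y) N.+ (oddAfter x y N.+ k)       ≡⟨ regroup (1 N.⊓ x) (1 N.⊓ y) (isolated (x N.∸ 1)) (isolated (y N.∸ 1))
                                                                (oddKept (x N.∸ 1)) (oddKept (y N.∸ 1)) k ⟩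
  suc (sideCost x N.+ sideCost y) N.+ k              ≤⟨ NP.+-monoˡ-≤ k (gain-bound-arith x y) ⟩
  parity (x N.+ suc y) N.+ 4 N.+ k                   ≡⟨ swap-4 (parity (x N.+ suc y)) k ⟩
  parity (x N.+ suc y) N.+ k N.+ 4                   ≡⟨ cong (N._+ 4) (sym odd-G) ⟩
  oddComponents G N.+ 4                              ∎
  where
  open NP.≤-Reasoning
  regroup : ∀ a b c d e f k → suc (a N.+ b N.+ c N.+ d) N.+ (e N.+ f N.+ k) ≡ suc ((a N.+ c N.+ e) N.+ (b N.+ d N.+ f)) N.+ k
  regroup = solve-ℕ
  swap-4 : ∀ p k → p N.+ 4 N.+ k ≡ p N.+ k N.+ 4
  swap-4 = solve-ℕ

ComponentsAtMost : ℕ → State → Set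
ComponentsAtMost n G = All (λ C → length C N.≤ n) G

Move-ComponentsAtMost : ∀ {n c G r H} → ComponentsAtMost n G → Move c G r H → ComponentsAtMost n H
Move-ComponentsAtMost {n} = Move-All (λ C → length C N.≤ n)
  (λ xs ys h → NP.m+n≤o⇒m≤o (length xs) (subst (N._≤ n) (LP.length-++ xs) h))
  (λ xs ys h → NP.m+n≤o⇒n≤o (length xs) (subst (N._≤ n) (LP.length-++ xs) h))

pair-or-AtMost1 : ∀ G → ComponentsAtMost 2 G → (Σ Comp λ C → (C ∈ G) × (length C ≡ 2)) ⊎ ComponentsAtMost 1 G
pair-or-AtMost1 [] h = inj₂ []
pair-or-AtMost1 ((x ∷ y ∷ []) ∷ G) (h ∷ hs) = inj₁ (_ , here refl , refl)
pair-or-AtMost1 ([] ∷ G) (h ∷ hs) with pair-or-AtMost1 G hs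
... | inj₁ (C , i , e) = inj₁ (C , there i , e)
... | inj₂ s = inj₂ (N.z≤n ∷ s)
pair-or-AtMost1 ((x ∷ []) ∷ G) (h ∷ hs) with pair-or-AtMost1 G hs
... | inj₁ (C , i , e) = inj₁ (C , there i , e)
... | inj₂ s = inj₂ (N.s≤s N.z≤n ∷ s)
pair-or-AtMost1 ((x ∷ y ∷ z ∷ C) ∷ G) (N.s≤s (N.s≤s ()) ∷ hs)

white-singleton-or-no-white : ∀ G → ComponentsAtMost 1 G → ((white ∷ []) ∈ G) ⊎ All (λ C → white ∉ C) G
white-singleton-or-no-white [] h = inj₂ []
white-singleton-or-no-white ((white ∷ []) ∷ G) (h ∷ hs) = inj₁ (here refl)
white-singleton-or-no-white ([] ∷ G) (h ∷ hs) with white-singleton-or-no-white G hs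
... | inj₁ i = inj₁ (there i)
... | inj₂ a = inj₂ ((λ ()) ∷ a)
white-singleton-or-no-white ((black ∷ []) ∷ G) (h ∷ hs) with white-singleton-or-no-white G hs
... | inj₁ i = inj₁ (there i)
... | inj₂ a = inj₂ ((λ { (here ()) ; (there ()) }) ∷ a)
white-singleton-or-no-white ((x ∷ y ∷ C) ∷ G) (N.s≤s () ∷ hs)

SmallBounds : State → Set
SmallBounds G = AllAlternating G → ComponentsAtMost 2 G →
  (Rs G ≤ + 0) × (Ls G ≤ + 2) × (ComponentsAtMost 1 G → Ls G ≤ + 1)

small-bounds : ∀ G → SmallBounds G
small-bounds = move-induction SmallBounds step
  where
  step : ∀ G → (∀ {c r H} → Move c G r H → SmallBounds H) → SmallBounds G
  step G IH hA hS = Rs≤0 , Ls≤ 2 hS , Ls≤ 1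
    where
    IH′ : ∀ {c r H} → Move c G r H → (Rs H ≤ + 0) × (Ls H ≤ + 2) × (ComponentsAtMost 1 H → Ls H ≤ + 1)
    IH′ m = IH m (Move-AllAlternating hA m) (Move-ComponentsAtMost hS m)

    Ls≤ : ∀ n → ComponentsAtMost n G → Ls G ≤ + n
    Ls≤ n hn = Ls-≤ (λ _ → +≤+ N.z≤n) λ {r} m →
      ZP.≤-trans (ZP.+-monoʳ-≤ (+ r) (proj₁ (IH′ m)))
        (+≤+ (subst (N._≤ n) (sym (NP.+-identityʳ r)) (NP.≤-trans (Move-gain≤length m) (All-lookup hn (Move-comp∈ m)))))

    -- Right takes a whole domino, or else a lone white vertex, or has no move at all.
    Rs≤0 : Rs G ≤ + 0
    Rs≤0 with pair-or-AtMost1 G hS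
    Rs≤0 | inj₁ (C , i , e) with ∈⇒↭-head i | All-lookup hA i
    Rs≤0 | inj₁ (black ∷ _ ∷ [] , i , e) | R , p | refl , _ =
      let m = move-at white _ R (black ∷ []) [] p refl in ZP.≤-trans (Rs-≤-Move m) (ZP.+-monoˡ-≤ (- + 2) (proj₁ (proj₂ (IH′ m))))
    Rs≤0 | inj₁ (white ∷ _ ∷ [] , i , e) | R , p | refl , _ =
      let m = move-at white _ R [] (black ∷ []) p refl in ZP.≤-trans (Rs-≤-Move m) (ZP.+-monoˡ-≤ (- + 2) (proj₁ (proj₂ (IH′ m))))
    Rs≤0 | inj₂ s1 with white-singleton-or-no-white G s1
    Rs≤0 | inj₂ s1 | inj₁ i with ∈⇒↭-head i
    ... | R , p = let m = move-at white _ R [] [] p refl in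
      ZP.≤-trans (Rs-≤-Move m) (ZP.+-monoˡ-≤ (- + 1) (proj₂ (proj₂ (IH′ m)) (Move-ComponentsAtMost s1 m)))
    Rs≤0 | inj₂ s1 | inj₂ a = ZP.≤-reflexive (Rs-NoMove (All∉⇒NoMove a))

twice : ℕ → ℕ
twice zero = zero
twice (suc t) = suc (suc (twice t))

even-or-odd : ∀ m → Σ ℕ λ t → (m ≡ twice t) ⊎ (m ≡ suc (twice t))
even-or-odd zero = 0 , inj₁ refl
even-or-odd (suc zero) = 0 , inj₂ refl
even-or-odd (suc (suc m)) with even-or-odd m
... | t , inj₁ e = suc t , inj₁ (cong (λ z → suc (suc z)) e)
... | t , inj₂ e = suc t , inj₂ (cong (λ z → suc (suc z)) e)

oddKept-twice : ∀ t → oddKept (twice t) ≡ 0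
oddKept-twice zero = refl
oddKept-twice (suc zero) = refl
oddKept-twice (suc (suc t)) = oddKept-twice (suc t)

isolated-twice : ∀ t → isolated (twice t) ≡ 0
isolated-twice zero = refl
isolated-twice (suc t) = refl

parity-twice-suc : ∀ t k → parity (suc (twice t N.+ k)) ≡ parity (suc k)
parity-twice-suc zero k = refl
parity-twice-suc (suc t) k = parity-twice-suc t k

parity-twice-1 : ∀ t → parity (suc (twice t)) ≡ 1
parity-twice-1 zero = refl
parity-twice-1 (suc t) = parity-twice-1 t

length-altPath : ∀ c n → length (altPath c n) ≡ n
length-altPath c zero = refl
length-altPath c (suc n) = cong suc (length-altPath (flip c) n)

Alternating⇒altPath : ∀ p l → Alternating (p ∷ l) → p ∷ l ≡ altPath p (suc (length l))
Alternating⇒altPath p [] h = refl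
Alternating⇒altPath p (q ∷ l) (refl , h) = cong (p ∷_) (Alternating⇒altPath (flip p) l h)

altPath-snoc3 : ∀ t → altPath black (suc (suc (suc (suc (twice t))))) ≡ altPath black (suc (twice t)) ++ white ∷ black ∷ white ∷ []
altPath-snoc3 zero = refl
altPath-snoc3 (suc t) = cong (λ z → black ∷ white ∷ z) (altPath-snoc3 t)

GoodSplit : ℕ → ℕ → Set
GoodSplit x y = oddAfter x y N.+ 4 N.≤ suc (extraGain x y) N.+ parity (x N.+ suc y)

good-gain-end : ∀ t → GoodSplit 1 (suc (twice t))
good-gain-end t rewrite oddKept-twice t | isolated-twice t | parity-twice-1 t = ≤-compute

good-gain-even : ∀ t → GoodSplit (suc (twice t)) 2
good-gain-even t rewrite oddKept-twice t | isolated-twice t | parity-twice-suc t 3 = ≤-compute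

good-gain-third : ∀ m → GoodSplit 2 m
good-gain-third zero = ≤-compute
good-gain-third (suc zero) = ≤-compute
good-gain-third (suc (suc zero)) = ≤-compute
good-gain-third (suc (suc (suc n))) = NP.≤-reflexive (NP.+-comm (parity n) 4)

good-shape : ∀ {G r H} (s : MoveShape G r H) → GoodSplit (MoveShape.before s) (MoveShape.after s) →
  oddComponents H N.+ 4 N.≤ r N.+ oddComponents G
good-shape {G} {r} {H} (shape x y k odd-G odd-H refl) good = begin
  oddComponents H N.+ 4                                     ≡⟨ cong (N._+ 4) odd-H ⟩
  oddAfter x y N.+ k N.+ 4                                  ≡⟨ swap-4 (oddAfter x y) k ⟩
  oddAfter x y N.+ 4 N.+ k                                  ≤⟨ NP.+-monoˡ-≤ k good ⟩
  suc (extraGain x y) N.+ parity (x N.+ suc y) N.+ k        ≡⟨ NP.+-assoc (suc (extraGain x y)) _ k ⟩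
  suc (extraGain x y) N.+ (parity (x N.+ suc y) N.+ k)      ≡⟨ cong (suc (extraGain x y) N.+_) (sym odd-G) ⟩
  r N.+ oddComponents G                                     ∎
  where
  open NP.≤-Reasoning
  swap-4 : ∀ p k → p N.+ k N.+ 4 ≡ p N.+ 4 N.+ k
  swap-4 = solve-ℕ

GoodRightMove : State → Set
GoodRightMove G = Σ ℕ λ r → Σ State λ H → Move white G r H × (oddComponents H N.+ 4 N.≤ r N.+ oddComponents G)

good-move-at : ∀ {G} C R a b → G ↭ C ∷ R → C ≡ a ++ white ∷ b → GoodSplit (length a) (length b) → GoodRightMove G
good-move-at C R a b p e good = _ , _ , m , good-shape (Move-shape m) good
  where m = move-at white C R a b p e

-- On a path starting with white Right plays the third vertex; on a path starting with black he plays
-- the second vertex if the length is odd and the third from the end if it is even.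
good-Right-move : ∀ {G} C R → G ↭ C ∷ R → Alternating C → 3 N.≤ length C → GoodRightMove G
good-Right-move (white ∷ l) R p h le with Alternating⇒altPath white l h
... | e with length l | le
... | zero | N.s≤s ()
... | suc zero | N.s≤s (N.s≤s ())
... | suc (suc m) | _ =
  good-move-at (white ∷ l) R (white ∷ black ∷ []) (altPath black m) p e
    (subst (GoodSplit 2) (sym (length-altPath black m)) (good-gain-third m))
good-Right-move (black ∷ l) R p h le with Alternating⇒altPath black l h
... | e with length l | le
... | zero | N.s≤s ()
... | suc zero | N.s≤s (N.s≤s ())
... | suc (suc m) | _ with even-or-odd m
... | t , inj₁ refl =
  good-move-at (black ∷ l) R (black ∷ []) (altPath black (suc (twice t))) p e
    (subst (GoodSplit 1) (sym (length-altPath black (suc (twice t)))) (good-gain-end t))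
... | t , inj₂ refl =
  good-move-at (black ∷ l) R (altPath black (suc (twice t))) (black ∷ white ∷ []) p (trans e (altPath-snoc3 t))
    (subst (λ x → GoodSplit x 2) (sym (length-altPath black (suc (twice t)))) (good-gain-even t))

long-or-AtMost2 : ∀ G → (Σ Comp λ C → (C ∈ G) × (3 N.≤ length C)) ⊎ ComponentsAtMost 2 G
long-or-AtMost2 [] = inj₂ []
long-or-AtMost2 (C ∷ G) with 3 N.≤? length C
... | yes q = inj₁ (C , here refl , q)
... | no q with long-or-AtMost2 G
... | inj₁ (C' , i , q') = inj₁ (C' , there i , q')
... | inj₂ s = inj₂ (NP.≤-pred (NP.≰⇒> q) ∷ s)

m≤r+n⇒m-r≤n : ∀ m r n → m N.≤ r N.+ n → + m - + r ≤ + n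
m≤r+n⇒m-r≤n m r n h = subst (+ m - + r ≤_) (cancel (+ r) (+ n)) (ZP.+-monoˡ-≤ (- + r) (+≤+ h))
  where
  cancel : ∀ (a b : ℤ) → a + b - a ≡ b
  cancel = solve-∀

UpperBounds : State → Set
UpperBounds G = AllAlternating G → (Ls G ≤ + (oddComponents G N.+ 4)) × (Rs G ≤ + oddComponents G)

upper-bounds : ∀ G → UpperBounds G
upper-bounds = move-induction UpperBounds step
  where
  step : ∀ G → (∀ {c r H} → Move c G r H → UpperBounds H) → UpperBounds G
  step G IH hA = Ls≤ , Rs≤
    where
    Ls≤ : Ls G ≤ + (oddComponents G N.+ 4)
    Ls≤ = Ls-≤ (λ _ → +≤+ N.z≤n) λ {r} m →
      ZP.≤-trans (ZP.+-monoʳ-≤ (+ r) (proj₂ (IH m (Move-AllAlternating hA m)))) (+≤+ (Move-gain-bound m))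

    Rs≤ : Rs G ≤ + oddComponents G
    Rs≤ with long-or-AtMost2 G
    ... | inj₂ s = ZP.≤-trans (proj₁ (small-bounds G hA s)) (+≤+ N.z≤n)
    ... | inj₁ (C , i , q) with ∈⇒↭-head i
    ... | R , p with good-Right-move C R p (All-lookup hA i) q
    ... | r , H , m , good =
      ZP.≤-trans (Rs-≤-Move m) (ZP.≤-trans (ZP.+-monoˡ-≤ (- + r) (proj₁ (IH m (Move-AllAlternating hA m))))
          (m≤r+n⇒m-r≤n _ r (oddComponents G) good))

-- Exchanging the colours and the lower bound

swapComp : Comp → Comp
swapComp = map flip

swapColours : State → State
swapColours = map swapComp

flip-involutive : ∀ c → flip (flip c) ≡ c
flip-involutive black = refl
flip-involutive white = refl

swapComp-involutive : ∀ C → swapComp (swapComp C) ≡ C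
swapComp-involutive [] = refl
swapComp-involutive (x ∷ C) = cong₂ _∷_ (flip-involutive x) (swapComp-involutive C)

swapColours-involutive : ∀ G → swapColours (swapColours G) ≡ G
swapColours-involutive [] = refl
swapColours-involutive (C ∷ G) = cong₂ _∷_ (swapComp-involutive C) (swapColours-involutive G)

isoCount-swapComp : ∀ l → isoCount (swapComp l) ≡ isoCount l
isoCount-swapComp [] = refl
isoCount-swapComp (x ∷ []) = refl
isoCount-swapComp (x ∷ y ∷ l) = refl

keep-swapComp : ∀ l → keep (swapComp l) ≡ swapColours (keep l)
keep-swapComp [] = refl
keep-swapComp (x ∷ []) = refl
keep-swapComp (x ∷ y ∷ l) = refl

length-swapComp : ∀ l → length (swapComp l) ≡ length l
length-swapComp l = LP.length-map flip l

playAt-swap : ∀ a c b → playAt (swapComp a , flip c , swapComp b) ≡ (proj₁ (playAt (a , c , b)) , swapColours (proj₂ (playAt (a , c , b))))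
playAt-swap a c b rewrite length-swapComp a | length-swapComp b
  | LP.take-map {f = flip} (length a N.∸ 1) a | LP.drop-map {f = flip} 1 b
  | isoCount-swapComp (take (length a N.∸ 1) a) | isoCount-swapComp (drop 1 b)
  | keep-swapComp (take (length a N.∸ 1) a) | keep-swapComp (drop 1 b)
  = cong (proj₁ (playAt (a , c , b)) ,_) (sym (LP.map-++ swapComp (keep (take (length a N.∸ 1) a)) (keep (drop 1 b))))

Move-swap : ∀ {c G r H} → Move c G r H → Move (flip c) (swapColours G) r (swapColours H)
Move-swap {c} {G} {r} {H} (move C R a b p ce re o) =
  move (swapComp C) (swapColours R) (swapComp a) (swapComp b) (map⁺ swapComp p)
     (trans (cong swapComp ce) (LP.map-++ flip a (c ∷ b)))
     (trans re (cong proj₁ (sym (playAt-swap a c b))))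
     (↭-trans (map⁺ swapComp o) (↭-reflexive (trans (LP.map-++ swapComp (proj₂ (playAt (a , c , b))) R)
        (cong (_++ swapColours R) (cong proj₂ (sym (playAt-swap a c b)))))))

Move-swap⁻ : ∀ {c G r H} → Move c (swapColours G) r H → Move (flip c) G r (swapColours H)
Move-swap⁻ {c} {G} {r} {H} m = subst (λ X → Move (flip c) X r (swapColours H)) (swapColours-involutive G) (Move-swap m)

size-swap : ∀ G → size (swapColours G) ≡ size G
size-swap [] = refl
size-swap (C ∷ G) = cong₂ N._+_ (length-swapComp C) (size-swap G)

oddComponents-swap : ∀ G → oddComponents (swapColours G) ≡ oddComponents G
oddComponents-swap [] = refl
oddComponents-swap (C ∷ G) = cong₂ N._+_ (cong parity (length-swapComp C)) (oddComponents-swap G)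

Alternating-swap : ∀ C → Alternating C → Alternating (swapComp C)
Alternating-swap [] h = tt
Alternating-swap (x ∷ []) h = tt
Alternating-swap (x ∷ y ∷ C) (refl , h) = refl , Alternating-swap (y ∷ C) h

AllAlternating-swap : ∀ G → AllAlternating G → AllAlternating (swapColours G)
AllAlternating-swap [] h = []
AllAlternating-swap (C ∷ G) (h ∷ hs) = Alternating-swap C h ∷ AllAlternating-swap G hs

i≤-j-k⇒k+j≤-i : ∀ (i j k : ℤ) → i ≤ - j - k → k + j ≤ - i
i≤-j-k⇒k+j≤-i i j k h = subst (_≤ - i) (e k j) (ZP.neg-mono-≤ h)
  where
  e : ∀ (k j : ℤ) → - (- j - k) ≡ k + j
  e = solve-∀

k-j≤i⇒-i≤j-k : ∀ (i j k : ℤ) → k - j ≤ i → - i ≤ j - k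
k-j≤i⇒-i≤j-k i j k h = subst (- i ≤_) (e k j) (ZP.neg-mono-≤ h)
  where
  e : ∀ (k j : ℤ) → - (k - j) ≡ j - k
  e = solve-∀

Ls-swap : ∀ G → Ls (swapColours G) ≡ - Rs G
Ls-swap = size-induction _ step
  where
  step : ∀ G → (∀ {H} → size H N.< size G → Ls (swapColours H) ≡ - Rs H) → Ls (swapColours G) ≡ - Rs G
  step G IH = ZP.≤-antisym upper (subst (- Rs G ≤_) (ZP.neg-involutive _) (ZP.neg-mono-≤ lower))

    where
    Rs-swap : ∀ {H} → size H N.< size G → Rs (swapColours H) ≡ - Ls H
    Rs-swap {H} lt = begin
      Rs (swapColours H)                      ≡⟨ sym (ZP.neg-involutive _) ⟩
      - (- Rs (swapColours H))                ≡⟨ cong -_ (sym (IH {swapColours H} (subst (N._< size G) (sym (size-swap H)) lt))) ⟩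
      - Ls (swapColours (swapColours H))      ≡⟨ cong (λ X → - Ls X) (swapColours-involutive H) ⟩
      - Ls H                                  ∎
      where open ≡-Reasoning

    upper : Ls (swapColours G) ≤ - Rs G
    upper = Ls-≤ {swapColours G} (λ nm → ZP.≤-reflexive (sym (cong -_ (Rs-NoMove {G} λ r H m → nm r (swapColours H) (Move-swap m)))))
      λ {r} {H} m → i≤-j-k⇒k+j≤-i (Rs G) (Rs H) (+ r)
        (subst (λ z → Rs G ≤ z - + r) (IH {H} (subst (size H N.<_) (size-swap G) (Move-size-< m))) (Rs-≤-Move {G} (Move-swap⁻ m)))

    lower : - Ls (swapColours G) ≤ Rs G
    lower = Rs-≥ {G} (λ nm → ZP.≤-reflexive (cong -_ (Ls-NoMove {swapColours G} λ r H m → nm r (swapColours H) (Move-swap⁻ m))))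
      λ {r} {H} m → k-j≤i⇒-i≤j-k (Ls (swapColours G)) (Ls H) (+ r)
        (subst (λ z → + r + z ≤ Ls (swapColours G)) (Rs-swap {H} (Move-size-< m)) (Ls-≥-Move {swapColours G} (Move-swap m)))

Rs-lower-bound : ∀ G → AllAlternating G → - + (oddComponents G N.+ 4) ≤ Rs G
Rs-lower-bound G hA = begin
  - + (oddComponents G N.+ 4)              ≡⟨ cong (λ k → - + (k N.+ 4)) (sym (oddComponents-swap G)) ⟩
  - + (oddComponents (swapColours G) N.+ 4) ≤⟨ ZP.neg-mono-≤ (proj₁ (upper-bounds (swapColours G) (AllAlternating-swap G hA))) ⟩
  - Ls (swapColours G)                     ≡⟨ cong -_ (Ls-swap G) ⟩
  - (- Rs G)                               ≡⟨ ZP.neg-involutive _ ⟩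
  Rs G                                     ∎
  where open ZP.≤-Reasoning

-- No zugzwang

init-++ : ∀ (A : Comp) y L → init (A ++ y ∷ L) ≡ A ++ init (y ∷ L)
init-++ [] y L = refl
init-++ (z ∷ A) y L rewrite LP.length-++ A {y ∷ L} | NP.+-suc (length A) (length L) =
  cong (z ∷_) (trans (cong (λ n → take n (A ++ y ∷ L)) (sym eq)) (init-++ A y L))
  where
  eq : length (A ++ y ∷ L) N.∸ 1 ≡ length A N.+ length L
  eq rewrite LP.length-++ A {y ∷ L} | NP.+-suc (length A) (length L) = refl

init-snoc : ∀ (A : Comp) x → init (A ++ x ∷ []) ≡ A
init-snoc A x = trans (init-++ A x []) (LP.++-identityʳ A)

init-drop-1 : ∀ (M : Comp) → init (drop 1 M) ≡ drop 1 (init M)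
init-drop-1 [] = refl
init-drop-1 (x ∷ []) = refl
init-drop-1 (x ∷ y ∷ M) = refl

keep-long : ∀ l → 2 N.≤ length l → keep l ≡ l ∷ []
keep-long (x ∷ y ∷ l) _ = refl
keep-long [] ()
keep-long (x ∷ []) (N.s≤s ())

∈-keep⁻ : ∀ {C l} → C ∈ keep l → (C ≡ l) × (2 N.≤ length l)
∈-keep⁻ {C} {x ∷ y ∷ l} (here refl) = refl , N.s≤s (N.s≤s N.z≤n)

∷-↭-∷-cases : ∀ {A : Set} {x y : A} {xs ys} → x ∷ xs ↭ y ∷ ys →
  ((x ≡ y) × (xs ↭ ys)) ⊎ (Σ (List A) λ zs → (xs ↭ y ∷ zs) × (ys ↭ x ∷ zs))
∷-↭-∷-cases {A} {x} {y} {xs} {ys} p with ∈-resp-↭ (↭-sym p) (here refl)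
... | here refl = inj₁ (refl , drop-∷ p)
... | there h with ∈-∃++ h
... | l , r , refl = inj₂ (l ++ r , shift y l r , drop-mid [] (x ∷ l) (↭-sym p))

↭-pieces-cases : ∀ {C' R'} l l' R → C' ∷ R' ↭ (keep l ++ keep l') ++ R →
  ((C' ≡ l) × (2 N.≤ length l) × (R' ↭ keep l' ++ R)) ⊎
  ((C' ≡ l') × (2 N.≤ length l') × (R' ↭ keep l ++ R)) ⊎
  (Σ State λ Z → (R ↭ C' ∷ Z) × (R' ↭ (keep l ++ keep l') ++ Z))
↭-pieces-cases {C'} {R'} l l' R p with ∈-++⁻ (keep l ++ keep l') (∈-resp-↭ p (here refl))
... | inj₂ h with ∈-∃++ h
... | z1 , z2 , refl = inj₂ (inj₂ (z1 ++ z2 , shift C' z1 z2 ,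
        ↭-trans (drop-mid [] ((keep l ++ keep l') ++ z1) (↭-trans p (↭-reflexive (sym (LP.++-assoc (keep l ++ keep l') z1 (C' ∷ z2))))))
          (↭-reflexive (LP.++-assoc (keep l ++ keep l') z1 z2))))
↭-pieces-cases {C'} {R'} l l' R p | inj₁ h with ∈-++⁻ (keep l) h
... | inj₁ h1 with ∈-keep⁻ {C'} {l} h1
... | refl , le rewrite keep-long l le = inj₁ (refl , le , drop-∷ p)
↭-pieces-cases {C'} {R'} l l' R p | inj₁ h | inj₂ h1 with ∈-keep⁻ {C'} {l'} h1
... | refl , le rewrite keep-long l' le = inj₂ (inj₁ (refl , le ,
        drop-mid [] (keep l) (↭-trans p (↭-reflexive (LP.++-assoc (keep l) (C' ∷ []) R)))))

++-∷-cases : ∀ (a : Comp) v b (a' : Comp) v' b' → a ++ v ∷ b ≡ a' ++ v' ∷ b' →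
  ((a ≡ a') × (v ≡ v') × (b ≡ b')) ⊎
  (Σ Comp λ M → (a ≡ a' ++ v' ∷ M) × (b' ≡ M ++ v ∷ b)) ⊎
  (Σ Comp λ M → (a' ≡ a ++ v ∷ M) × (b ≡ M ++ v' ∷ b'))
++-∷-cases [] v b [] v' b' refl = inj₁ (refl , refl , refl)
++-∷-cases [] v b (x ∷ a') v' b' refl = inj₂ (inj₂ (a' , refl , refl))
++-∷-cases (x ∷ a) v b [] v' b' refl = inj₂ (inj₁ (a , refl , refl))
++-∷-cases (x ∷ a) v b (y ∷ a') v' b' e with LP.∷-injective e
... | refl , e' with ++-∷-cases a v b a' v' b' e'
... | inj₁ (refl , refl , refl) = inj₁ (refl , refl , refl)
... | inj₂ (inj₁ (M , refl , refl)) = inj₂ (inj₁ (M , refl , refl))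
... | inj₂ (inj₂ (M , refl , refl)) = inj₂ (inj₂ (M , refl , refl))

-- Moves at vertices p < q of one path such that the remnant of each move containing the other vertex
-- is kept: each move stays available after the other, and both orders lead to the same position.
record Commuting (cp cq : Colour) (A : Comp) (x : Colour) (M B : Comp) (R : State) : Set where
  field
    right-after-left : Move cq (proj₂ (playAt (A , cp , (x ∷ M) ++ cq ∷ B)) ++ R)
      (proj₁ (playAt (M , cq , B))) (proj₂ (playAt (M , cq , B)) ++ (keep (init A) ++ R))
    left-after-right : Move cp (proj₂ (playAt (A ++ cp ∷ x ∷ M , cq , B)) ++ R)
      (proj₁ (playAt (A , cp , init (x ∷ M)))) (proj₂ (playAt (A , cp , init (x ∷ M))) ++ (keep (drop 1 B) ++ R))
    same-result : proj₂ (playAt (M , cq , B)) ++ (keep (init A) ++ R) ↭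
                  proj₂ (playAt (A , cp , init (x ∷ M))) ++ (keep (drop 1 B) ++ R)

commute : ∀ cp cq (A : Comp) x M B R →
  2 N.≤ length (M ++ cq ∷ B) → 2 N.≤ length (A ++ cp ∷ init (x ∷ M)) → Commuting cp cq A x M B R
commute cp cq A x M B R h1 h2 = record
  { right-after-left = move-at cq L1 (u ++ R) M B p1 refl
  ; left-after-right = move-at cp L2 (t ++ R) A (init (x ∷ M)) p2 refl
  ; same-result = same
  }
  where
  u = keep (init A)
  t = keep (drop 1 B)
  s = keep (init M)
  L1 = M ++ cq ∷ B
  L2 = A ++ cp ∷ init (x ∷ M)
  p1 : proj₂ (playAt (A , cp , (x ∷ M) ++ cq ∷ B)) ++ R ↭ L1 ∷ (u ++ R)
  p1 = ↭-trans (↭-reflexive (cong (λ z → (u ++ z) ++ R) (keep-long L1 h1)))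
         (↭-trans (↭-reflexive (LP.++-assoc u (L1 ∷ []) R)) (shift L1 u R))
  p2 : proj₂ (playAt (A ++ cp ∷ x ∷ M , cq , B)) ++ R ↭ L2 ∷ (t ++ R)
  p2 = ↭-reflexive (cong (λ z → (z ++ t) ++ R) (trans (cong keep (init-++ A cp (x ∷ M))) (keep-long L2 h2)))
  same : (s ++ t) ++ (u ++ R) ↭ (u ++ keep (drop 1 (init (x ∷ M)))) ++ (t ++ R)
  same rewrite sym (init-drop-1 (x ∷ M)) =
    ↭-trans (↭-reflexive (LP.++-assoc s t (u ++ R)))
      (↭-trans (++⁺ˡ s (shifts t u))
        (↭-trans (shifts s u)
            (↭-reflexive (sym (LP.++-assoc u s (t ++ R))))))

Alternating-without-black : ∀ l → Alternating l → black ∉ l → length l N.≤ 1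
Alternating-without-black [] h n = N.z≤n
Alternating-without-black (x ∷ []) h n = N.s≤s N.z≤n
Alternating-without-black (black ∷ y ∷ l) h n = ⊥-elim (n (here refl))
Alternating-without-black (white ∷ y ∷ l) (refl , h) n = ⊥-elim (n (there (here refl)))

-j≤v-r : ∀ (v : ℤ) (k r j : ℕ) → + k ≤ v → r N.≤ k N.+ j → - + j ≤ v - + r
-j≤v-r v k r j h le =
  ZP.≤-trans (ZP.≤-reflexive (e (+ k) (+ j)))
    (ZP.≤-trans (ZP.+-monoʳ-≤ (+ k) (ZP.neg-mono-≤ (+≤+ le))) (ZP.+-monoˡ-≤ (- + r) h))
  where
  e : ∀ (k j : ℤ) → - j ≡ k + - (k + j)
  e = solve-∀

Move-comp-without-black : ∀ {G c r H} → AllAlternating G → NoMove black G → (m : Move c G r H) → length (Move.comp m) N.≤ 1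
Move-comp-without-black hA nb m = Alternating-without-black (Move.comp m) (All-lookup hA (Move-comp∈ m))
    (λ i → All-lookup (NoMove⇒All∉ nb) (Move-comp∈ m) i)

-- Right's move takes at most one vertex, after which Left cannot move and the game ends.
Rs≥-1-without-black : ∀ G → AllAlternating G → NoMove black G → - + 1 ≤ Rs G
Rs≥-1-without-black G hA nb = Rs-≥ (λ _ → -≤+) (λ {r} {H} m →
  -j≤v-r (Ls H) 0 r 1 (ZP.≤-reflexive (sym (Ls-NoMove {H} (NoMove-Move nb m))))
    (NP.≤-trans (Move-gain≤length m) (Move-comp-without-black hA nb m)))

playAt-short : ∀ a c b → length (a ++ c ∷ b) N.≤ 2 → proj₂ (playAt (a , c , b)) ≡ []
playAt-short [] c [] _ = refl
playAt-short [] c (y ∷ []) _ = refl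
playAt-short (x ∷ []) c [] _ = refl
playAt-short [] c (y ∷ z ∷ b) (N.s≤s (N.s≤s ()))
playAt-short (x ∷ []) c (y ∷ b) (N.s≤s (N.s≤s ()))
playAt-short (x ∷ w ∷ a) c b (N.s≤s (N.s≤s le)) with subst (N._≤ 0) (LP.length-++ a {c ∷ b}) le
... | q with NP.m+n≤o⇒n≤o (length a) q
... | ()

Move-short : ∀ {c G r H} (m : Move c G r H) → length (Move.comp m) N.≤ 2 → H ↭ Move.rest m
Move-short (move C R a b p refl re o) le = ↭-trans o (↭-reflexive (cong (_++ R) (playAt-short a _ b le)))

-- If Right does not take the domino, Left takes it and ends up in the situation of Rs≥-1-without-black.
Rs≥-2-domino-without-black : ∀ R → AllAlternating R → NoMove black R → - + 2 ≤ Rs ((black ∷ white ∷ []) ∷ R)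
Rs≥-2-domino-without-black R hA nb = Rs-≥ (λ _ → -≤+) step
  where
  step : ∀ {r H} → Move white ((black ∷ white ∷ []) ∷ R) r H → - + 2 ≤ Ls H - + r
  step {r} {H} m with ∷-↭-∷-cases (Move.split m)
  ... | inj₁ (e , q) =
    -j≤v-r (Ls H) 0 r 2 (ZP.≤-reflexive (sym (trans (Ls-resp-↭ (↭-trans (Move-short m short) (↭-sym q))) (Ls-NoMove {R} nb))))
      (NP.≤-trans (Move-gain≤length m) short)
    where
    short : length (Move.comp m) N.≤ 2
    short = subst (λ z → length z N.≤ 2) e NP.≤-refl
  ... | inj₂ (Z , q1 , q2) = -j≤v-r (Ls H) 1 r 2 vlH (NP.≤-trans (Move-gain≤length m) (NP.≤-trans lenC (NP.m≤m+n 1 2)))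
    where
    hAZ : AllAlternating (Move.comp m ∷ Z)
    hAZ = All-resp-↭ q1 hA
    nbZ' : All (λ C → black ∉ C) (Move.comp m ∷ Z)
    nbZ' = All-resp-↭ q1 (NoMove⇒All∉ nb)
    lenC : length (Move.comp m) N.≤ 1
    lenC with hAZ | nbZ'
    ... | h ∷ _ | n ∷ _ = Alternating-without-black (Move.comp m) h n
    hZ : AllAlternating Z
    hZ with hAZ
    ... | _ ∷ h = h
    nbZ : NoMove black Z
    nbZ with nbZ'
    ... | _ ∷ n = All∉⇒NoMove n
    mL : Move black ((black ∷ white ∷ []) ∷ Z) 2 Z
    mL = move-at black (black ∷ white ∷ []) Z [] (white ∷ []) ↭-refl refl
    vlZ : + 1 ≤ Ls ((black ∷ white ∷ []) ∷ Z)
    vlZ = ZP.≤-trans (ZP.+-monoʳ-≤ (+ 2) (Rs≥-1-without-black Z hZ nbZ)) (Ls-≥-Move mL)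
    vlH : + 1 ≤ Ls H
    vlH = ZP.≤-trans vlZ (ZP.≤-reflexive (Ls-resp-↭ (↭-sym (↭-trans (Move-short m (NP.≤-trans lenC (NP.n≤1+n 1))) q2))))

keep-without-black : ∀ l → Alternating l → All (λ C → black ∉ C) (keep l) → length l N.≤ 1
keep-without-black [] h n = N.z≤n
keep-without-black (x ∷ []) h n = N.s≤s N.z≤n
keep-without-black (x ∷ y ∷ l) h (n ∷ []) = Alternating-without-black (x ∷ y ∷ l) h n

Ls≥0-by-move : ∀ {G ru H} (j : ℕ) → Move black G ru H → - + j ≤ Rs H → j N.≤ ru → + 0 ≤ Ls G
Ls≥0-by-move {G} {ru} {H} j m h le = ZP.≤-trans (-j≤v-r (+ ru) ru j 0 ZP.≤-refl (NP.≤-trans le (NP.≤-reflexive (sym (NP.+-identityʳ ru)))))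
   (ZP.≤-trans (ZP.+-monoʳ-≤ (+ ru) h) (Ls-≥-Move m))

Ls≥0-short-sides : ∀ {G} C R a b → G ↭ C ∷ R → C ≡ a ++ white ∷ b → Alternating (a ++ white ∷ b) →
    AllAlternating R → NoMove black R →
  length (init a) N.≤ 1 → length (drop 1 b) N.≤ 1 → + 0 ≤ Ls G
Ls≥0-short-sides C R [] [] p refl h hR nbR la lb =
  ZP.≤-reflexive (sym (Ls-NoMove (All∉⇒NoMove (All-resp-↭ (↭-sym p) ((λ { (here ()) ; (there ()) }) ∷ NoMove⇒All∉ nbR)))))
Ls≥0-short-sides C R [] (y ∷ []) p refl (refl , _) hR nbR la lb =
  Ls≥0-by-move 1 (move-at black C R (white ∷ []) [] p refl) (Rs≥-1-without-black R hR nbR) (N.s≤s N.z≤n)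
Ls≥0-short-sides C R [] (y ∷ z ∷ []) p refl (refl , refl , _) hR nbR la lb =
  Ls≥0-by-move 1 (move-at black C R (white ∷ []) (white ∷ []) p refl) (Rs≥-1-without-black R hR nbR) (N.s≤s N.z≤n)
Ls≥0-short-sides C R (black ∷ []) [] p refl h hR nbR la lb =
  Ls≥0-by-move 1 (move-at black C R [] (white ∷ []) p refl) (Rs≥-1-without-black R hR nbR) (N.s≤s N.z≤n)
Ls≥0-short-sides C R (black ∷ []) (y ∷ []) p refl (refl , refl , _) hR nbR la lb =
  Ls≥0-by-move 1 (move-at black C R [] (white ∷ black ∷ []) p refl) (Rs≥-1-without-black R hR nbR) (N.s≤s N.z≤n)
Ls≥0-short-sides C R (black ∷ []) (y ∷ z ∷ []) p refl (refl , refl , refl , _) hR nbR la lb =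
  Ls≥0-by-move 1 (move-at black C R (black ∷ white ∷ []) (white ∷ []) p refl) (Rs≥-1-without-black R hR nbR) (N.s≤s N.z≤n)
Ls≥0-short-sides C R (white ∷ black ∷ []) [] p refl (refl , _) hR nbR la lb =
  Ls≥0-by-move 1 (move-at black C R (white ∷ []) (white ∷ []) p refl) (Rs≥-1-without-black R hR nbR) (N.s≤s N.z≤n)
Ls≥0-short-sides C R (white ∷ black ∷ []) (y ∷ []) p refl (refl , refl , refl , _) hR nbR la lb =
  Ls≥0-by-move 1 (move-at black C R (white ∷ []) (white ∷ black ∷ []) p refl) (Rs≥-1-without-black R hR nbR) (N.s≤s N.z≤n)
Ls≥0-short-sides C R (white ∷ black ∷ []) (y ∷ z ∷ []) p refl (refl , refl , refl , refl , _) hR nbR la lb =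
  Ls≥0-by-move 2 (move-at black C R (white ∷ []) (white ∷ black ∷ white ∷ []) p refl)
      (Rs≥-2-domino-without-black R hR nbR) (N.s≤s (N.s≤s N.z≤n))
Ls≥0-short-sides C R (white ∷ []) b p refl (() , _) hR nbR la lb
Ls≥0-short-sides C R (w ∷ white ∷ []) b p refl (_ , () , _) hR nbR la lb
Ls≥0-short-sides C R (black ∷ black ∷ []) b p refl (() , _) hR nbR la lb
Ls≥0-short-sides C R (x ∷ y ∷ z ∷ a) b p ce h hR nbR (N.s≤s ()) lb
Ls≥0-short-sides C R a (y ∷ z ∷ w ∷ b) p ce h hR nbR la (N.s≤s ())

-- If Left cannot answer Right's move, every other component has at most one (white) vertex and
-- Right's move leaves at most one vertex on either side, so Left has a move securing a nonnegative score.
RightMoveHurtsLeft-no-reply : ∀ {G r G'} → AllAlternating G → Move white G r G' → NoMove black G' → + 0 - + r ≤ Ls G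
RightMoveHurtsLeft-no-reply {G} {r} {G'} hA (move C R a b p ce re o) nb =
  ZP.≤-trans (ZP.≤-trans (ZP.≤-reflexive (ZP.+-identityˡ _)) (ZP.neg-≤-pos {r} {0})) core
  where
  hCR : AllAlternating (C ∷ R)
  hCR = All-resp-↭ p hA
  hC : Alternating C
  hC with hCR
  ... | h ∷ _ = h
  hR : AllAlternating R
  hR with hCR
  ... | _ ∷ h = h
  nbs : All (λ C → black ∉ C) ((keep (init a) ++ keep (drop 1 b)) ++ R)
  nbs = All-resp-↭ o (NoMove⇒All∉ nb)
  nbQ = AllP.++⁻ˡ (keep (init a) ++ keep (drop 1 b)) nbs
  nbR = AllP.++⁻ʳ (keep (init a) ++ keep (drop 1 b)) nbs
  hC' : Alternating (a ++ white ∷ b)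
  hC' = subst Alternating ce hC
  la : length (init a) N.≤ 1
  la = keep-without-black (init a) (Alternating-take _ a (Alternating-++⁻ˡ a _ hC')) (AllP.++⁻ˡ (keep (init a)) nbQ)
  lb : length (drop 1 b) N.≤ 1
  lb = keep-without-black (drop 1 b) (Alternating-drop 1 b (Alternating-drop 1 (white ∷ b) (Alternating-++⁻ʳ a _ hC'))) (AllP.++⁻ʳ (keep (init a)) nbQ)
  core : + 0 ≤ Ls G
  core = Ls≥0-short-sides C R a b p ce hC' hR (All∉⇒NoMove nbR) la lb

flipⁿ : ℕ → Colour → Colour
flipⁿ zero c = c
flipⁿ (suc n) c = flipⁿ n (flip c)

Alternating-distance : ∀ p L q B → Alternating (p ∷ L ++ q ∷ B) → q ≡ flipⁿ (suc (length L)) p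
Alternating-distance p [] q B (e , _) = e
Alternating-distance p (z ∷ L) q B (refl , h) = Alternating-distance (flip p) L q B h

Alternating-adjacent : ∀ A x y B → Alternating (A ++ x ∷ y ∷ B) → y ≡ flip x
Alternating-adjacent A x y B h = Alternating-distance x [] y B (Alternating-++⁻ʳ A (x ∷ y ∷ B) h)

flipⁿ-black≡white⇒odd : ∀ n → flipⁿ n black ≡ white → parity n ≡ 1
flipⁿ-black≡white⇒odd zero ()
flipⁿ-black≡white⇒odd (suc zero) e = refl
flipⁿ-black≡white⇒odd (suc (suc n)) e = flipⁿ-black≡white⇒odd n e

flipⁿ-white≡black⇒odd : ∀ n → flipⁿ n white ≡ black → parity n ≡ 1
flipⁿ-white≡black⇒odd zero ()
flipⁿ-white≡black⇒odd (suc zero) e = refl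
flipⁿ-white≡black⇒odd (suc (suc n)) e = flipⁿ-white≡black⇒odd n e

odd-suc⇒not-isolated : ∀ n → parity (suc n) ≡ 1 → isolated n ≡ 0
odd-suc⇒not-isolated zero e = refl
odd-suc⇒not-isolated (suc zero) ()
odd-suc⇒not-isolated (suc (suc n)) e = refl

isoCount-long≡0 : ∀ l → 2 N.≤ length l → isoCount l ≡ 0
isoCount-long≡0 (x ∷ y ∷ l) _ = refl
isoCount-long≡0 [] ()
isoCount-long≡0 (x ∷ []) (N.s≤s ())

length≥2 : ∀ (A : Comp) u v L → 2 N.≤ length (A ++ u ∷ v ∷ L)
length≥2 A u v L = subst (2 N.≤_) (sym (LP.length-++ A)) (NP.≤-trans (N.s≤s (N.s≤s N.z≤n)) (NP.m≤n+m _ (length A)))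

length-snoc : ∀ (L : Comp) x → length (L ++ x ∷ []) ≡ suc (length L)
length-snoc L x = trans (LP.length-++ L) (NP.+-comm (length L) 1)

snoc-view : ∀ (a : Comp) → (a ≡ []) ⊎ (Σ Comp λ a₀ → Σ Colour λ x → a ≡ a₀ ++ x ∷ [])
snoc-view [] = inj₁ refl
snoc-view (y ∷ a) with snoc-view a
... | inj₁ refl = inj₂ ([] , y , refl)
... | inj₂ (a₀ , x , refl) = inj₂ (y ∷ a₀ , x , refl)

RightMoveHurtsLeft : State → Set
RightMoveHurtsLeft G = ∀ {r G'} → Move white G r G' → Ls G' - + r ≤ Ls G

ExtraMoveHelpsRight : State → Set
ExtraMoveHelpsRight G = ∀ {r G'} → Move white G r G' → Rs G' - + r ≤ Rs G

gains-agree : ∀ {g g' h z r s t u} → g' N.+ r ≡ g → h N.+ s ≡ g → z N.+ t ≡ g' → z N.+ u ≡ h → t N.+ r ≡ u N.+ s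
gains-agree {g} {g'} {h} {z} {r} {s} {t} {u} e₁ e₂ e₃ e₄ = NP.+-cancelˡ-≡ z _ _ (begin
  z N.+ (t N.+ r)  ≡⟨ sym (NP.+-assoc z t r) ⟩
  z N.+ t N.+ r    ≡⟨ cong (N._+ r) e₃ ⟩
  g' N.+ r         ≡⟨ trans e₁ (sym e₂) ⟩
  h N.+ s          ≡⟨ cong (N._+ s) (sym e₄) ⟩
  z N.+ u N.+ s    ≡⟨ NP.+-assoc z u s ⟩
  z N.+ (u N.+ s)  ∎)
  where open ≡-Reasoning

≤-sub-gains : ∀ (i x j : ℤ) (t r u s : ℕ) → i ≤ x - + t → x - + u ≤ j → t N.+ r ≡ u N.+ s → i - + r ≤ j - + s
≤-sub-gains i x j t r u s i≤ ≤j e = begin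
  i - + r               ≤⟨ ZP.+-monoˡ-≤ (- + r) i≤ ⟩
  x - + t - + r         ≡⟨ regroup x (+ t) (+ r) ⟩
  x - (+ t + + r)       ≡⟨ cong (λ n → x - + n) e ⟩
  x - (+ u + + s)       ≡⟨ sym (regroup x (+ u) (+ s)) ⟩
  x - + u - + s         ≤⟨ ZP.+-monoˡ-≤ (- + s) ≤j ⟩
  j - + s               ∎
  where
  open ZP.≤-Reasoning
  regroup : ∀ (x p q : ℤ) → x - p - q ≡ x - (p + q)
  regroup = solve-∀

-- Comparing Right's moves m (to G') and m' (to H) in G: each of G' and H leads to a common Z
-- with at most one further Right move.
extra-move-bound : ∀ {G G' H Z r s t u} → Move white G r G' → Move white G s H →
  Rs G' ≤ Ls Z - + t → size Z N.+ t ≡ size G' → Ls Z - + u ≤ Ls H → size Z N.+ u ≡ size H →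
  Rs G' - + r ≤ Ls H - + s
extra-move-bound {Z = Z} {r} {s} {t} {u} m m' below e₁ above e₂ =
  ≤-sub-gains _ (Ls Z) _ t r u s below above (gains-agree (Move-size m) (Move-size m') e₁ e₂)

≤⇒≤-0 : ∀ {i j : ℤ} → i ≤ j → i ≤ j - + 0
≤⇒≤-0 {i} = subst (i ≤_) (sym (ZP.+-identityʳ _))

Ls-sub-0-≤ : ∀ {G H} → G ↭ H → Ls G - + 0 ≤ Ls H
Ls-sub-0-≤ q = ZP.≤-reflexive (trans (ZP.+-identityʳ _) (Ls-resp-↭ q))

extra-move-commuting : ∀ {G G' H X Y r s r₂ r₁} → Move white G r G' → Move white G s H →
  Move white G' r₂ X → Move white H r₁ Y → X ↭ Y → RightMoveHurtsLeft H → Rs G' - + r ≤ Ls H - + s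
extra-move-commuting {X = X} m m' mX mY q hurts =
  extra-move-bound {Z = X} m m' (Rs-≤-Move mX) (Move-size mX)
    (subst (λ z → z - + _ ≤ _) (Ls-resp-↭ (↭-sym q)) (hurts mY)) (trans (cong (N._+ _) (size-↭ q)) (Move-size mY))

extra-move-via-H : ∀ {G G' H G'' r s r₁} → Move white G r G' → Move white G s H → Move white H r₁ G'' → G' ↭ G'' →
  Rs G' ≤ Ls G' → RightMoveHurtsLeft H → Rs G' - + r ≤ Ls H - + s
extra-move-via-H {G' = G'} m m' mH q Rs≤Ls hurts =
  extra-move-bound {Z = G'} m m' (≤⇒≤-0 Rs≤Ls) (NP.+-identityʳ _)
    (subst (λ z → z - + _ ≤ _) (Ls-resp-↭ (↭-sym q)) (hurts mH)) (trans (cong (N._+ _) (size-↭ q)) (Move-size mH))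

extra-move-via-G' : ∀ {G G' H X r s r₂} → Move white G r G' → Move white G s H → Move white G' r₂ X → X ↭ H →
  Rs G' - + r ≤ Ls H - + s
extra-move-via-G' {X = X} m m' mX q =
  extra-move-bound {Z = X} m m' (Rs-≤-Move mX) (Move-size mX) (Ls-sub-0-≤ q) (trans (NP.+-identityʳ _) (size-↭ q))

extra-move-same : ∀ {G G' H r s} → Move white G r G' → Move white G s H → G' ↭ H → Rs G' ≤ Ls G' →
  Rs G' - + r ≤ Ls H - + s
extra-move-same {G' = G'} m m' q Rs≤Ls =
  extra-move-bound {Z = G'} m m' (≤⇒≤-0 Rs≤Ls) (NP.+-identityʳ _) (Ls-sub-0-≤ q) (trans (NP.+-identityʳ _) (size-↭ q))

-- In G Left plays his reply first; Right's move m is still available and leads to the same position,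
-- and by `helps` Right gains nothing from having m played for him.
left-reply-commuting : ∀ {G G' X Gu Y r ru ru' r₁} → Move white G r G' → Move black G' ru X → Ls G' ≡ + ru + Rs X →
  Move black G ru' Gu → Move white Gu r₁ Y → X ↭ Y → ExtraMoveHelpsRight Gu → r ≡ r₁ → Ls G' - + r ≤ Ls G
left-reply-commuting {G} {G'} {X} {Gu} {Y} {r} {ru} {ru'} {r₁} m mu v mGu mY q helps refl = begin
  Ls G' - + r          ≡⟨ cong (_- + r) v ⟩
  + ru + Rs X - + r    ≡⟨ ZP.+-assoc (+ ru) (Rs X) (- + r) ⟩
  + ru + (Rs X - + r)  ≡⟨ cong (λ z → + ru + (z - + r)) (Rs-resp-↭ q) ⟩
  + ru + (Rs Y - + r)  ≤⟨ ZP.+-monoʳ-≤ (+ ru) (helps mY) ⟩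
  + ru + Rs Gu         ≡⟨ cong (λ n → + n + Rs Gu) ru≡ru' ⟩
  + ru' + Rs Gu        ≤⟨ Ls-≥-Move mGu ⟩
  Ls G                 ∎
  where
  open ZP.≤-Reasoning
  ru≡ru' : ru ≡ ru'
  ru≡ru' = NP.+-cancelʳ-≡ r ru ru' (trans (gains-agree (Move-size m) (Move-size mGu) (Move-size mu)
    (trans (cong (N._+ r) (size-↭ q)) (Move-size mY))) (NP.+-comm r ru'))

1⊓length≡1 : ∀ (l : Comp) → 1 N.≤ length l → 1 N.⊓ length l ≡ 1
1⊓length≡1 (x ∷ l) _ = refl

playAt-gain-left : ∀ a c b → 1 N.≤ length a → isoCount (init a) ≡ 0 →
  proj₁ (playAt (a , c , b)) ≡ suc (1 N.+ (1 N.⊓ length b) N.+ 0 N.+ isoCount (drop 1 b))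
playAt-gain-left a c b h e = cong suc (cong₂ N._+_ (cong₂ N._+_ (cong (N._+ (1 N.⊓ length b)) (1⊓length≡1 a h)) e) refl)

playAt-gain-right : ∀ a c b → 1 N.≤ length b → isoCount (drop 1 b) ≡ 0 →
  proj₁ (playAt (a , c , b)) ≡ suc ((1 N.⊓ length a) N.+ 1 N.+ isoCount (init a) N.+ 0)
playAt-gain-right a c b h e = cong suc (cong₂ N._+_ (cong (N._+ isoCount (init a)) (cong ((1 N.⊓ length a) N.+_) (1⊓length≡1 b h))) e)

++-snoc-assoc : ∀ (au : Comp) p (bu : Comp) x q b → ((au ++ p ∷ bu) ++ x ∷ []) ++ q ∷ b ≡ au ++ p ∷ ((bu ++ x ∷ []) ++ q ∷ b)
++-snoc-assoc [] p bu x q b = refl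
++-snoc-assoc (z ∷ au) p bu x q b = cong (z ∷_) (++-snoc-assoc au p bu x q b)

length≥1 : ∀ (A : Comp) u L → 1 N.≤ length (A ++ u ∷ L)
length≥1 A u L = subst (1 N.≤_) (sym (LP.length-++ A)) (NP.≤-trans (N.s≤s N.z≤n) (NP.m≤n+m _ (length A)))

ExtraMoveHelpsRightNext : State → Set
ExtraMoveHelpsRightNext G = ∀ {c r' H} → Move c G r' H → ExtraMoveHelpsRight H

-- Alternation makes the distance between Left's black and Right's white vertex odd; hence Right's move
-- leaves no isolated vertex on the left either before or after Left's reply, and the moves commute.
left-reply-before : ∀ {G r G' ru X} C R au bu x b Ru →
  G ↭ C ∷ R → C ≡ ((au ++ black ∷ bu) ++ x ∷ []) ++ white ∷ b → r ≡ proj₁ (playAt ((au ++ black ∷ bu) ++ x ∷ [] , white , b)) →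
  Alternating C → X ↭ proj₂ (playAt (au , black , bu)) ++ Ru → Ru ↭ keep (drop 1 b) ++ R → Ls G' ≡ + ru + Rs X →
  Move white G r G' → Move black G' ru X → ExtraMoveHelpsRightNext G → Ls G' - + r ≤ Ls G
left-reply-before {G} {r} {G'} {ru} {X} C R au bu x b Ru p ce re hC qX qR v m mu helps
  with flipⁿ-black≡white⇒odd (suc (length (bu ++ x ∷ [])))
      (sym (Alternating-distance black (bu ++ x ∷ []) white b
      (Alternating-++⁻ʳ au _ (subst Alternating (trans ce (++-snoc-assoc au black bu x white b)) hC))))
left-reply-before C R au [] x b Ru p ce re hC qX qR v m mu helps | ()
left-reply-before {G} {r} {G'} {ru} {X} C R au (y ∷ bu') x b Ru p ce re hC qX qR v m mu helps | pe =
  left-reply-commuting m mu v mGu right-after-left qq (helps mGu)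
      (trans re (trans (playAt-gain-left a white b (length≥1 (au ++ black ∷ y ∷ bu') x []) isoA)
     (sym (playAt-gain-left (bu' ++ x ∷ []) white b (length≥1 bu' x []) isoB))))
  where
  a = (au ++ black ∷ y ∷ bu') ++ x ∷ []
  pe' : parity (suc (length bu')) ≡ 1
  pe' = subst (λ z → parity z ≡ 1) (length-snoc bu' x) pe
  isoB : isoCount (init (bu' ++ x ∷ [])) ≡ 0
  isoB = trans (cong isoCount (init-snoc bu' x)) (trans (isoCount≡isolated bu') (odd-suc⇒not-isolated (length bu') pe'))
  isoA : isoCount (init a) ≡ 0
  isoA = trans (cong isoCount (init-snoc (au ++ black ∷ y ∷ bu') x)) (isoCount-long≡0 _ (length≥2 au black y bu'))
  ceL : C ≡ au ++ black ∷ ((y ∷ bu' ++ x ∷ []) ++ white ∷ b)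
  ceL = trans ce (++-snoc-assoc au black (y ∷ bu') x white b)
  h1 : 2 N.≤ length ((bu' ++ x ∷ []) ++ white ∷ b)
  h1 = subst (λ z → 2 N.≤ length z) (sym (LP.++-assoc bu' (x ∷ []) (white ∷ b))) (length≥2 bu' x white b)
  h2 : 2 N.≤ length (au ++ black ∷ init (y ∷ bu' ++ x ∷ []))
  h2 = subst (λ z → 2 N.≤ length (au ++ black ∷ z)) (sym (init-snoc (y ∷ bu') x)) (length≥2 au black y bu')
  cm = commute black white au y (bu' ++ x ∷ []) b R h1 h2
  mGu = move-at black C R au ((y ∷ bu' ++ x ∷ []) ++ white ∷ b) p ceL
  open Commuting cm
  qq : X ↭ proj₂ (playAt (bu' ++ x ∷ [] , white , b)) ++ (keep (init au) ++ R)
  qq = ↭-trans qX (↭-trans (++⁺ˡ _ qR)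
      (↭-trans (↭-reflexive (cong (λ z → proj₂ (playAt (au , black , z)) ++ (keep (drop 1 b) ++ R)) (sym (init-snoc (y ∷ bu') x))))
        (↭-sym same-result)))

left-reply-after′ : ∀ {G r G' ru X} C R a y au bu Ru →
  G ↭ C ∷ R → C ≡ a ++ white ∷ y ∷ (au ++ black ∷ bu) → r ≡ proj₁ (playAt (a , white , y ∷ (au ++ black ∷ bu))) →
  Alternating C → X ↭ proj₂ (playAt (au , black , bu)) ++ Ru → Ru ↭ keep (init a) ++ R → Ls G' ≡ + ru + Rs X →
  Move white G r G' → Move black G' ru X → ExtraMoveHelpsRightNext G → Ls G' - + r ≤ Ls G
left-reply-after′ {G} {r} {G'} {ru} {X} C R a y au bu Ru p ce re hC qX qR v m mu helps
  with flipⁿ-white≡black⇒odd (suc (length (y ∷ au)))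
      (sym (Alternating-distance white (y ∷ au) black bu (Alternating-++⁻ʳ a _ (subst Alternating ce hC))))
left-reply-after′ C R a y [] bu Ru p ce re hC qX qR v m mu helps | ()
left-reply-after′ {G} {r} {G'} {ru} {X} C R a y (z ∷ au') bu Ru p ce re hC qX qR v m mu helps | pe =
  left-reply-commuting m mu v mGu left-after-right (↭-trans qq same-result) (helps mGu) (trans re (trans g1 (sym g2)))
  where
  h1 : 2 N.≤ length ((z ∷ au') ++ black ∷ bu)
  h1 = N.s≤s (length≥1 au' black bu)
  h2 : 2 N.≤ length (a ++ white ∷ init (y ∷ z ∷ au'))
  h2 = length≥2 a white y _
  cm = commute white black a y (z ∷ au') bu R h1 h2
  open Commuting cm
  ceL : C ≡ (a ++ white ∷ y ∷ z ∷ au') ++ black ∷ bu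
  ceL = trans ce (sym (LP.++-assoc a (white ∷ y ∷ z ∷ au') (black ∷ bu)))
  mGu = move-at black C R (a ++ white ∷ y ∷ z ∷ au') bu p ceL
  qq : X ↭ proj₂ (playAt (z ∷ au' , black , bu)) ++ (keep (init a) ++ R)
  qq = ↭-trans qX (++⁺ˡ _ qR)
  g1 : proj₁ (playAt (a , white , y ∷ z ∷ (au' ++ black ∷ bu))) ≡ suc ((1 N.⊓ length a) N.+ 1 N.+ isoCount (init a) N.+ 0)
  g1 = playAt-gain-right a white (y ∷ z ∷ (au' ++ black ∷ bu)) (N.s≤s N.z≤n)
      (isoCount-long≡0 (z ∷ (au' ++ black ∷ bu)) (N.s≤s (length≥1 au' black bu)))
  g2 : proj₁ (playAt (a , white , init (y ∷ z ∷ au'))) ≡ suc ((1 N.⊓ length a) N.+ 1 N.+ isoCount (init a) N.+ 0)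
  g2 = playAt-gain-right a white (init (y ∷ z ∷ au')) (N.s≤s N.z≤n)
         (trans (isoCount≡isolated (init (z ∷ au'))) (trans (cong isolated (length-init (z ∷ au'))) (odd-suc⇒not-isolated (length au') pe)))

left-reply-after : ∀ {G r G' ru X} C R a b au bu Ru → 2 N.≤ length (drop 1 b) → drop 1 b ≡ au ++ black ∷ bu →
  G ↭ C ∷ R → C ≡ a ++ white ∷ b → r ≡ proj₁ (playAt (a , white , b)) →
  Alternating C → X ↭ proj₂ (playAt (au , black , bu)) ++ Ru → Ru ↭ keep (init a) ++ R → Ls G' ≡ + ru + Rs X →
  Move white G r G' → Move black G' ru X → ExtraMoveHelpsRightNext G → Ls G' - + r ≤ Ls G
left-reply-after C R a [] au bu Ru () e p ce re hC qX qR v m mu helps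
left-reply-after C R a (y ∷ b₁) au bu Ru le2 refl p ce re hC qX qR v m mu helps = left-reply-after′ C R a y au bu Ru p ce re hC qX qR v m mu helps

Ls≥0-without-white : ∀ {G} → NoMove white G → + 0 ≤ Ls G
Ls≥0-without-white {G} nm with Ls-cases G
... | inj₁ (_ , v) = ZP.≤-reflexive (sym v)
... | inj₂ (ru , X , mu , v) = subst (+ 0 ≤_) (sym v)
        (subst (λ z → + 0 ≤ + ru + z) (sym (Rs-NoMove {X} (NoMove-Move nm mu))) (+≤+ N.z≤n))

keep-init-white : ∀ (u : Colour) a₁ x → keep (init ((u ∷ a₁) ++ white ∷ x ∷ [])) ≡ ((u ∷ a₁) ++ white ∷ []) ∷ []
keep-init-white u a₁ x = trans (cong keep (init-++ (u ∷ a₁) white (x ∷ []))) (keep-long _ (N.s≤s (length≥1 a₁ white [])))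

extra-move-earlier : ∀ {G r G' r'' H} C R R'' a'' M b → C ≡ (a'' ++ white ∷ M) ++ white ∷ b → Alternating C → R ↭ R'' →
  Move white G r G' → Move white G r'' H →
  G' ↭ proj₂ (playAt (a'' ++ white ∷ M , white , b)) ++ R →
  H ↭ proj₂ (playAt (a'' , white , M ++ white ∷ b)) ++ R'' →
  Rs G' ≤ Ls G' → RightMoveHurtsLeft H → Rs G' - + r ≤ Ls H - + r''
extra-move-earlier C R R'' a'' [] b ce hC q m m'' o o'' Rs≤Ls hurts
  with Alternating-adjacent a'' white white b (subst Alternating (trans ce (LP.++-assoc a'' (white ∷ []) (white ∷ b))) hC)
... | ()
extra-move-earlier C R R'' a'' (x ∷ y ∷ M'') b ce hC q m m'' o o'' Rs≤Ls hurts =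
  extra-move-commuting m m'' (Move-resp-↭ (↭-sym o) left-after-right)
      (Move-resp-↭ (↭-sym (↭-trans o'' (++⁺ˡ _ (↭-sym q)))) right-after-left)
      (↭-sym same-result) hurts
  where
  cm = commute white white a'' x (y ∷ M'') b R (N.s≤s (length≥1 M'' white b)) (length≥2 a'' white x _)
  open Commuting cm
extra-move-earlier C R R'' (u ∷ a₁) (x ∷ []) (z ∷ b₁) ce hC q m m'' o o'' Rs≤Ls hurts =
  extra-move-commuting m m'' (Move-resp-↭ (↭-sym o) left-after-right)
      (Move-resp-↭ (↭-sym (↭-trans o'' (++⁺ˡ _ (↭-sym q)))) right-after-left)
      (↭-sym same-result) hurts
  where
  cm = commute white white (u ∷ a₁) x [] (z ∷ b₁) R (N.s≤s (N.s≤s N.z≤n)) (N.s≤s (length≥1 a₁ white []))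
  open Commuting cm
extra-move-earlier C R R'' [] (x ∷ []) (z ∷ b₁) ce hC q m m'' o o'' Rs≤Ls hurts =
  extra-move-via-H m m'' mS (↭-trans o (++⁺ˡ (keep b₁) q)) Rs≤Ls hurts
  where
  mS = move-at white (white ∷ z ∷ b₁) R'' [] (z ∷ b₁) o'' refl
extra-move-earlier C R R'' (u ∷ a₁) (x ∷ []) [] ce hC q m m'' o o'' Rs≤Ls hurts =
  extra-move-via-G' m m'' mX (↭-trans (++⁺ˡ _ q) (↭-sym o''))
  where
  pX = ↭-trans o (↭-reflexive (cong (_++ R) (trans (LP.++-identityʳ _) (keep-init-white u a₁ x))))
  mX = move-at white ((u ∷ a₁) ++ white ∷ []) R (u ∷ a₁) [] pX refl
extra-move-earlier C R R'' [] (x ∷ []) [] ce hC q m m'' o o'' Rs≤Ls hurts =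
  extra-move-same m m'' (↭-trans o (↭-trans q (↭-sym o''))) Rs≤Ls

extra-move-later : ∀ {G r G' r'' H} C R R'' a M b'' → C ≡ a ++ white ∷ M ++ white ∷ b'' → Alternating C → R ↭ R'' →
  Move white G r G' → Move white G r'' H →
  G' ↭ proj₂ (playAt (a , white , M ++ white ∷ b'')) ++ R →
  H ↭ proj₂ (playAt (a ++ white ∷ M , white , b'')) ++ R'' →
  Rs G' ≤ Ls G' → RightMoveHurtsLeft H → Rs G' - + r ≤ Ls H - + r''
extra-move-later C R R'' a [] b'' ce hC q m m'' o o'' Rs≤Ls hurts with Alternating-adjacent a white white b'' (subst Alternating ce hC)
... | ()
extra-move-later C R R'' a (x ∷ y ∷ M'') b'' ce hC q m m'' o o'' Rs≤Ls hurts =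
  extra-move-commuting m m'' (Move-resp-↭ (↭-sym o) right-after-left)
      (Move-resp-↭ (↭-sym (↭-trans o'' (++⁺ˡ _ (↭-sym q)))) left-after-right)
      same-result hurts
  where
  cm = commute white white a x (y ∷ M'') b'' R (N.s≤s (length≥1 M'' white b'')) (length≥2 a white x _)
  open Commuting cm
extra-move-later C R R'' (u ∷ a₁) (x ∷ []) (z ∷ b₁) ce hC q m m'' o o'' Rs≤Ls hurts =
  extra-move-commuting m m'' (Move-resp-↭ (↭-sym o) right-after-left)
      (Move-resp-↭ (↭-sym (↭-trans o'' (++⁺ˡ _ (↭-sym q)))) left-after-right)
      same-result hurts
  where
  cm = commute white white (u ∷ a₁) x [] (z ∷ b₁) R (N.s≤s (N.s≤s N.z≤n)) (N.s≤s (length≥1 a₁ white []))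
  open Commuting cm
extra-move-later C R R'' [] (x ∷ []) (z ∷ b₁) ce hC q m m'' o o'' Rs≤Ls hurts =
  extra-move-via-G' m m'' mX (↭-trans (++⁺ˡ _ q) (↭-sym o''))
  where
  mX = move-at white (white ∷ z ∷ b₁) R [] (z ∷ b₁) o refl
extra-move-later C R R'' (u ∷ a₁) (x ∷ []) [] ce hC q m m'' o o'' Rs≤Ls hurts =
  extra-move-via-H m m'' mS (↭-trans o (++⁺ˡ _ q)) Rs≤Ls hurts
  where
  pH = ↭-trans o'' (↭-reflexive (cong (_++ R'') (trans (LP.++-identityʳ _) (keep-init-white u a₁ x))))
  mS = move-at white ((u ∷ a₁) ++ white ∷ []) R'' (u ∷ a₁) [] pH refl
extra-move-later C R R'' [] (x ∷ []) [] ce hC q m m'' o o'' Rs≤Ls hurts =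
  extra-move-same m m'' (↭-trans o (↭-trans q (↭-sym o''))) Rs≤Ls

right-move-hurts-left : ∀ {G} → AllAlternating G → ExtraMoveHelpsRightNext G → RightMoveHurtsLeft G
right-move-hurts-left {G} hA helps {r} {G'} m@(move C R a b p ce re o) with Ls-cases G'
... | inj₁ (nm , v) = subst (λ z → z - + r ≤ Ls G) (sym v) (RightMoveHurtsLeft-no-reply hA m nm)
... | inj₂ (ru , X , mu@(move Cu Ru au bu pu ceu reu ou) , v) with ↭-pieces-cases (init a) (drop 1 b) R (↭-trans (↭-sym pu) o)
... | inj₂ (inj₂ (Z , q1 , q2)) = left-reply-commuting m mu v mGu mY qq (helps mGu) re
  where
  pG : G ↭ Cu ∷ C ∷ Z
  pG = ↭-trans p (↭-trans (prep C q1) (swap C Cu ↭-refl))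
  mGu = move-at black Cu (C ∷ Z) au bu pG ceu
  Qu = proj₂ (playAt (au , black , bu))
  Q = proj₂ (playAt (a , white , b))
  mY = move-at white C (Qu ++ Z) a b (shift C Qu Z) ce
  qq : X ↭ Q ++ (Qu ++ Z)
  qq = ↭-trans ou (↭-trans (++⁺ˡ Qu q2) (shifts Qu Q))
... | inj₂ (inj₁ (refl , le2 , q)) = left-reply-after C R a b au bu Ru le2 ceu p ce re (Move-Alternating hA m) ou q v m mu helps
... | inj₁ (refl , le2 , q) with snoc-view a
... | inj₁ refl with le2
... | ()
right-move-hurts-left {G} hA helps {r} {G'} m@(move C R a b p ce re o)
  | inj₂ (ru , X , mu@(move Cu Ru au bu pu ceu reu ou) , v) | inj₁ (refl , le2 , q) | inj₂ (a₀ , x , refl)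
  with trans (sym (init-snoc a₀ x)) ceu
... | refl = left-reply-before C R au bu x b Ru p ce re (Move-Alternating hA m) ou q v m mu helps

extra-move-helps-right : ∀ {G} → AllAlternating G → (∀ {c r H} → Move c G r H → RightMoveHurtsLeft H) →
  (∀ {c r H} → Move c G r H → Rs H ≤ Ls H) → ExtraMoveHelpsRight G
extra-move-helps-right {G} hA hurts Rs≤Ls m = Rs-≥ (λ nm → ⊥-elim (nm _ _ m)) (compare m)
  where
  compare : ∀ {r G' s H} → Move white G r G' → Move white G s H → Rs G' - + r ≤ Ls H - + s
  compare m@(move C R a b p ce re o) m'@(move C' R' a' b' p' ce' re' o') with ∷-↭-∷-cases (↭-trans (↭-sym p) p')
  ... | inj₂ (Z , q1 , q2) = extra-move-commuting m m' mX mY (shifts Q' Q) (hurts m')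
    where
    Q = proj₂ (playAt (a , white , b))
    Q' = proj₂ (playAt (a' , white , b'))
    mX = move-at white C' (Q ++ Z) a' b' (↭-trans o (↭-trans (++⁺ˡ Q q1) (shift C' Q Z))) ce'
    mY = move-at white C (Q' ++ Z) a b (↭-trans o' (↭-trans (++⁺ˡ Q' q2) (shift C Q' Z))) ce
  ... | inj₁ (refl , q) with ++-∷-cases a white b a' white b' (trans (sym ce) ce')
  ... | inj₁ (refl , _ , refl) = extra-move-same m m' (↭-trans o (↭-trans (++⁺ˡ _ q) (↭-sym o'))) (Rs≤Ls m)
  ... | inj₂ (inj₁ (M , refl , refl)) = extra-move-earlier C R R' a' M b ce (Move-Alternating hA m) q m m' o o' (Rs≤Ls m) (hurts m')
  ... | inj₂ (inj₂ (M , refl , refl)) = extra-move-later C R R' a M b' ce (Move-Alternating hA m) q m m' o o' (Rs≤Ls m) (hurts m')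

RightMoveHurtsLeft⇒Rs≤Ls : ∀ {G} → RightMoveHurtsLeft G → Rs G ≤ Ls G
RightMoveHurtsLeft⇒Rs≤Ls {G} hurts with Rs-cases G
... | inj₁ (nm , v) = subst (_≤ Ls G) (sym v) (Ls≥0-without-white nm)
... | inj₂ (r , H , m , v) = subst (_≤ Ls G) (sym v) (hurts m)

NoZugzwang : State → Set
NoZugzwang G = AllAlternating G → RightMoveHurtsLeft G × ExtraMoveHelpsRight G × (Rs G ≤ Ls G)

no-zugzwang : ∀ G → NoZugzwang G
no-zugzwang = move-induction NoZugzwang step
  where
  step : ∀ G → (∀ {c r H} → Move c G r H → NoZugzwang H) → NoZugzwang G
  step G IH hA = hurts , extra-move-helps-right hA (proj₁ ∘ next) (proj₂ ∘ proj₂ ∘ next) , RightMoveHurtsLeft⇒Rs≤Ls hurts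
    where
    next : ∀ {c r H} → Move c G r H → RightMoveHurtsLeft H × ExtraMoveHelpsRight H × (Rs H ≤ Ls H)
    next m = IH m (Move-AllAlternating hA m)
    hurts : RightMoveHurtsLeft G
    hurts = right-move-hurts-left hA (proj₁ ∘ proj₂ ∘ next)

-- The positions S n₁ + ⋯ + S nₚ

parity≡%2 : ∀ n → parity n ≡ n % 2
parity≡%2 zero = refl
parity≡%2 (suc zero) = refl
parity≡%2 (suc (suc n)) = trans (parity≡%2 n) (sym (trans (cong (_% 2) (NP.+-comm 2 n)) ([m+n]%n≡m%n n 2)))

length-S : ∀ n → length (S n) ≡ ∣ n ∣
length-S (+ m) = length-altPath black m
length-S -[1+ m ] = length-altPath white (suc m)

oddComponents-sumS : ∀ ns → oddComponents (sumS ns) ≡ oddCount ns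
oddComponents-sumS [] = refl
oddComponents-sumS (n ∷ ns) = cong₂ N._+_ (trans (cong parity (length-S n)) (parity≡%2 ∣ n ∣)) (oddComponents-sumS ns)

Alternating-altPath : ∀ c n → Alternating (altPath c n)
Alternating-altPath c zero = tt
Alternating-altPath c (suc zero) = tt
Alternating-altPath c (suc (suc n)) = refl , Alternating-altPath (flip c) (suc n)

AllAlternating-sumS : ∀ ns → AllAlternating (sumS ns)
AllAlternating-sumS [] = []
AllAlternating-sumS (+ m ∷ ns) = Alternating-altPath black m ∷ AllAlternating-sumS ns
AllAlternating-sumS (-[1+ m ] ∷ ns) = Alternating-altPath white (suc m) ∷ AllAlternating-sumS ns

corollary4 : (ns : List ℤ) (k : ℕ) → oddCount ns ≡ k →
    ((- (+ k)) - + 4 ≤ Rs (sumS ns)) × (Rs (sumS ns) ≤ Ls (sumS ns)) × (Ls (sumS ns) ≤ + k + + 4)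
corollary4 ns k refl = lower , proj₂ (proj₂ (no-zugzwang G alternating)) , upper
  where
  G = sumS ns
  alternating = AllAlternating-sumS ns

  lower : - (+ oddCount ns) - + 4 ≤ Rs G
  lower = begin
    - (+ oddCount ns) - + 4           ≡⟨ negate-+ (+ oddCount ns) (+ 4) ⟩
    - + (oddCount ns N.+ 4)           ≡⟨ cong (λ k → - + (k N.+ 4)) (sym (oddComponents-sumS ns)) ⟩
    - + (oddComponents G N.+ 4)       ≤⟨ Rs-lower-bound G alternating ⟩
    Rs G                              ∎
    where
    open ZP.≤-Reasoning
    negate-+ : ∀ (a b : ℤ) → - a - b ≡ - (a + b)
    negate-+ = solve-∀

  upper : Ls G ≤ + oddCount ns + + 4
  upper = subst (λ k → Ls G ≤ + (k N.+ 4)) (oddComponents-sumS ns) (proj₁ (upper-bounds G alternating))
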